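{- Let $U$ be a row-strict composition tableau with $k$ rows and longest row length $m$, and let $a<b\le c$ be positive integers. Suppose the insertion of $b$ into $U$ creates the new box in position $(i_b,j_b)$ of $U\leftarrow b$. With scanning values $b^i_j$, $c^i_j$, $a^i_j$ as defined in the context: (1) For $U\leftarrow b\leftarrow c$: (a) if $U\leftarrow b$ has the same number of rows as $U$, then $b^i_j\le c^i_j$ for all $(i,j)$ with $0\le i\le i_b$ when $j=j_b$, and with $0\le i\le k$ when $j_b<j<m+1$; (b) if $U\leftarrow b$ has one more row than $U$ (that is, $j_b=1$), then $b^i_j\le c^i_j$ for all $0\le i\le i_b$ and $1\le j\le m+1$, and $b^i_j\le c^{i+1}_j$ for all $i_b\le i\le k+1$ and $2\le j\le m+1$. (2) For $U\leftarrow b\leftarrow a$: (a) if $U\leftarrow b$ has the same number of rows as $U$, then $b^i_j> a^i_{j+1}$ for all $(i,j)$ with $0\le i\le i_b$ when $j=j_b$, and with $0\le i\le k$ when $j_b<j\le m$; (b) if $j_b=1$, then $b^i_j>a^i_{j+1}$ for all $0\le i\le i_b$ and $1\le j\le m$, and $b^i_j>a^{i+1}_{j+1}$ for all $i_b\le i\le k+1$ and $2\le j\le m+1$.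
   Context: Diagrams: row $i$ of the diagram of a strong composition $\alpha$ has $\alpha_i$ left-justified boxes; $(i,j)$ is row $i$ (from the top), column $j$. A row-strict composition tableau (RCT) of shape $\alpha$ ($k$ parts, largest part $m$) is a filling with positive integers such that the first column weakly increases top to bottom, each row strictly decreases left to right, and (Triple Rule) after padding rows with zeros to a $k\times m$ array $\hat U$, for $1\le i_1<i_2\le k$, $2\le j\le m$: $\hat U(i_2,j)\neq0$ and $\hat U(i_2,j)>\hat U(i_1,j)$ imply $\hat U(i_2,j)\ge\hat U(i_1,j-1)$. RCT insertion $U\leftarrow b$ ($U$ an RCT with longest row length $m$, $b$ a positive integer): scan $U$ column by column from right to left, each column from top to bottom, starting in column $m+1$ with $b$ in hand. (1) In column $m+1$: if the current position is at the end of a row of length $m$ and $b$ is strictly less than the last entry of that row, place $b$ there and stop; otherwise continue at the top of column $m$. (2) Inductively, with entry $b_j$ in hand at the top of column $j$: (a) if the current position is empty, is at the end of a row of length $j-1$, and $b_j$ is strictly less than the last entry of that row, place $b_j$ there and stop; (b) if the current position is nonempty and holds $\tilde b_j\le b_j$ with $b_j$ strictly less than the entry immediately to the left of $\tilde b_j$, then $b_j$ replaces (bumps) $\tilde b_j$ and scanning of column $j$ continues with $\tilde b_j$ in hand, bumping whenever possible; after the last entry of column $j$, scanning continues at the top of column $j-1$. (3) If an entry $b_1$ is bumped into the first column, it is placed in a new row of length one that appears directly after the lowest row whose first-column entry is weakly less than $b_1$. Column reading order: $(i,j)<_{col}(i',j')$ iff $j<j'$, or $j=j'$ and $i>i'$;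 it is used on all cells $(i,j)$ with $0\le i\le k$, $1\le j\le m+2$, whether or not they are boxes. Scanning values. $b^i_j$ is the entry in hand which scans the entry in row $i$, column $j$ of $U$ during the insertion of $b$ into $U$ (so when $b^i_j$ bumps in position $(i,j)$ the bumped entry is $b^{i+1}_j$, and otherwise $b^{i+1}_j=b^i_j$); $b^0_j$ is the entry that begins scanning at the top of column $j$, and $b^0_{m+1}:=b$; if the insertion of $b$ stops in position $(i_b,j_b)$, then $b^i_j:=0$ for all $(i,j)<_{col}(i_b,j_b)$. Likewise $c^i_j$ is the entry in hand compared against the entry in row $i$, column $j$ of $U\leftarrow b$ during the insertion of $c$ into $U\leftarrow b$, with $c^0_j$ the entry beginning to scan column $j$ (scanning starts in column $m+2$, and $c^0_{m+1}=c$ since $b\le c$), and $c^i_j:=0$ for $(i,j)<_{col}(i_c,j_c)$ where $(i_c,j_c)$ is where that insertion stops. Similarly $a^i_j$ is the entry in hand scanning row $i$, column $j$ of $U\leftarrow b$ during the insertion of $a$ into $U\leftarrow b$, with $a^0_j$ the entry beginning to scan column $j$, $a^0_{m+2}:=a$, and $a^i_j:=0$ for $(i,j)<_{col}(i_a,j_a)$ where $(i_a,j_a)$ is where that insertion stops. -}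

module Defs where

open import Data.Nat using (ℕ; zero; suc; _+_; _∸_; _≤_; _<_; _⊔_; _≡ᵇ_; _<ᵇ_; _≤ᵇ_)
open import Data.Bool using (Bool; true; false; if_then_else_; _∧_)
open import Data.List using (List; []; _∷_; _++_; [_]; length; take; drop; foldr)
open import Data.List.Relation.Unary.All using (All)
open import Relation.Binary.PropositionalEquality using (_≡_; _≢_)

-- Fillings of composition diagrams.
-- A filling is a list of rows (top to bottom); each row is the list of its
-- entries from left to right.  Rows and columns are 1-indexed.

Tab : Set
Tab = List (List ℕ)

-- entry in column j (1-indexed) of a row; 0 if there is no box there
at : List ℕ → ℕ → ℕ
at r zero = 0
at [] (suc j) = 0
at (x ∷ r) (suc zero) = x
at (x ∷ r) (suc (suc j)) = at r (suc j)

setAt : List ℕ → ℕ → ℕ → List ℕ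
setAt r zero v = r
setAt [] (suc j) v = []
setAt (x ∷ r) (suc zero) v = v ∷ r
setAt (x ∷ r) (suc (suc j)) v = x ∷ setAt r (suc j) v

-- row i (1-indexed) of a filling; [] if out of range
rowAt : Tab → ℕ → List ℕ
rowAt T zero = []
rowAt [] (suc i) = []
rowAt (r ∷ T) (suc zero) = r
rowAt (r ∷ T) (suc (suc i)) = rowAt T (suc i)

-- the padded array  Û(i,j)  (0 outside the diagram)
entry : Tab → ℕ → ℕ → ℕ
entry T i j = at (rowAt T i) j

rowLen : Tab → ℕ → ℕ
rowLen T i = length (rowAt T i)

numRows : Tab → ℕ
numRows = length

maxLen : Tab → ℕ
maxLen = foldr (λ r acc → length r ⊔ acc) 0

record IsRCT (T : Tab) : Set where
  field
    -- the shape is a strong composition: no empty rows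
    rowsNonempty : All (λ r → r ≢ []) T
    positive     : All (All (λ x → 0 < x)) T
    firstCol     : ∀ i → 1 ≤ i → suc i ≤ numRows T →
                   entry T i 1 ≤ entry T (suc i) 1
    rowStrict    : ∀ i j → 1 ≤ i → i ≤ numRows T → 1 ≤ j → suc j ≤ rowLen T i →
                   entry T i (suc j) < entry T i j
    triple       : ∀ i₁ i₂ j → 1 ≤ i₁ → i₁ < i₂ → i₂ ≤ numRows T →
                   2 ≤ j → j ≤ maxLen T →
                   entry T i₂ j ≢ 0 → entry T i₁ j < entry T i₂ j →
                   entry T i₁ (j ∸ 1) ≤ entry T i₂ j

-- what happens when the entry h in hand scans row r in column j (j ≥ 2)
data RowRes : Set where
  placed : List ℕ → RowRes
  bumped : List ℕ → ℕ → RowRes      -- (b): h bumps the entry, which is now in hand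
  skip   : RowRes

rowStep : ℕ → ℕ → List ℕ → RowRes
rowStep j h r =
  if (length r ≡ᵇ (j ∸ 1)) ∧ (h <ᵇ at r (j ∸ 1))
  then placed (r ++ [ h ])
  else (if (j ≤ᵇ length r) ∧ (at r j ≤ᵇ h) ∧ (h <ᵇ at r (j ∸ 1))
        then bumped (setAt r j h) (at r j)
        else skip)

data ColRes : Set where
  cstop : Tab → ℕ → ColRes   -- new filling, row (1-indexed) where the insertion stopped
  cgo   : Tab → ℕ → ColRes   -- new filling, entry in hand after the column

consRow : List ℕ → ColRes → ColRes
consRow r (cstop T i) = cstop (r ∷ T) (suc i)
consRow r (cgo T h) = cgo (r ∷ T) h

scanCol : ℕ → ℕ → Tab → ColRes
scanCol j h [] = cgo [] h
scanCol j h (r ∷ T) with rowStep j h r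
... | placed r′ = cstop (r′ ∷ T) 1
... | bumped r′ h′ = consRow r′ (scanCol j h′ T)
... | skip = consRow r (scanCol j h T)

-- hand values within one column:  colHand j h T i  is the entry in hand
-- scanning row i (i = 0: the entry beginning to scan the column; beyond the
-- last row: the entry in hand after the column); 0 after the insertion stopped.
colHand′ : ℕ → ℕ → Tab → ℕ → ℕ
colHand′ j h T zero = h
colHand′ j h [] (suc i) = h
colHand′ j h (r ∷ T) (suc i) with rowStep j h r
... | placed _ = 0
... | bumped _ h′ = colHand′ j h′ T i
... | skip = colHand′ j h T i

colHand : ℕ → ℕ → Tab → ℕ → ℕ
colHand j h T zero = h
colHand j h T (suc i) = colHand′ j h T i

-- step (3): index (1-indexed) of the lowest row whose first-column entry is
-- weakly less than x (0 if there is none)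
lowestLe : ℕ → Tab → ℕ
lowestLe x [] = 0
lowestLe x (r ∷ T) with lowestLe x T
... | zero = if at r 1 ≤ᵇ x then 1 else 0
... | suc n = suc (suc n)

newRowAfter : ℕ → ℕ → Tab → Tab
newRowAfter p x T = take p T ++ [ [ x ] ] ++ drop p T

record InsResult : Set where
  constructor result
  field
    tab    : Tab
    stopR  : ℕ                 -- row of the new box (in the resulting filling)
    stopC  : ℕ
    hand   : ℕ → ℕ → ℕ         -- hand i j : scanning value in row i, column j

-- insertion of x into T, scanning starting at the top of column N
-- (N ≥ 1 + longest row length; columns beyond the longest row + 1 are inert)
insertFrom : ℕ → ℕ → Tab → InsResult
afterCol : ℕ → ℕ → Tab → ColRes → InsResult

insertFrom zero x T = result T 0 0 (λ _ _ → 0)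
insertFrom (suc zero) x T =
  result (newRowAfter (lowestLe x T) x T) (suc (lowestLe x T)) 1
         (λ i j → if (j ≡ᵇ 1) ∧ (i ≤ᵇ suc (lowestLe x T)) then x else 0)
insertFrom (suc (suc n)) x T = afterCol (suc n) x T (scanCol (suc (suc n)) x T)

-- afterCol n x T r : continue after scanning column n+1 of T with x, result r
afterCol n x T (cstop T′ i) =
  result T′ i (suc n)
         (λ i′ j → if (j ≡ᵇ suc n) ∧ (i′ ≤ᵇ i)
                   then colHand (suc n) x T i′ else 0)
afterCol n x T (cgo T′ h) with insertFrom n h T′
... | result T″ r c hd =
  result T″ r c
         (λ i j → if j ≡ᵇ suc n then colHand (suc n) x T i
                  else (if j <ᵇ suc n then hd i j else 0))

-- U ← b : scanning starts in column m+1, m the longest row length of U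
insRes : Tab → ℕ → InsResult
insRes U b = insertFrom (suc (maxLen U)) b U

_←ᵣ_ : Tab → ℕ → Tab
U ←ᵣ b = InsResult.tab (insRes U b)

newRow newCol : Tab → ℕ → ℕ
newRow U b = InsResult.stopR (insRes U b)
newCol U b = InsResult.stopC (insRes U b)

-- scanning values b^i_j for the insertion of b into U (b^0_{m+1} = b)
scanB : Tab → ℕ → ℕ → ℕ → ℕ
scanB U b = InsResult.hand (insRes U b)

-- scanning values x^i_j for the insertion of x into U ← b, where scanning
-- starts at the top of column m+2 (x^0_{m+2} = x), m the longest row of U
scanNext : Tab → ℕ → ℕ → ℕ → ℕ → ℕ
scanNext U b x = InsResult.hand (insertFrom (suc (suc (maxLen U))) x (U ←ᵣ b))

-- Only two properties of an RCT are used: its entries are positive and its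
-- rows strictly decrease.  The proof compares the insertions column by
-- column, by induction on the starting column.
--   * An insertion of b first scans columns m+1, …, 2, producing a filling V
--     (each row changed only by entries ≤ b and at most one appended box),
--     then possibly adds a one-box row (scanColumns, insertion-decomposes).
--   * When the second insertion reaches column N it has only changed columns
--     > N, so its rows agree with V up to column N (AgreeUpTo); together with
--     the structure of V this relates them to b's rows after column N.
--   * Within one column, the two column comparison lemmas show that the
--     comparison of hands at the top of the column persists row by row, and
--     governs whether the scans pass the column (columnCompare-≤/-<).
--   * b's new one-box row is skipped by the later scans and only shifts the
--     rows below it (rowInert).
-- The column induction (compare-larger, compare-smaller) then gives parts
-- (1) and (2); c passes the extra column m+2 without change, and the values
-- of b are positive in the region of part (2) (hands-positive).

module Submission where

open import Defs
open import Data.Nat using (ℕ; zero; suc; _+_; _∸_; _≤_; _<_; z≤n; s≤s; _≡ᵇ_; _<ᵇ_; _≤ᵇ_)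
open import Data.Nat.Properties
open import Data.Bool using (Bool; true; false; if_then_else_; _∧_; T)
open import Data.Bool.Properties using (T-≡; T-∧)
open import Data.List using (List; []; _∷_; _++_; [_]; length)
open import Data.List.Properties using (length-++)
open import Data.List.Relation.Unary.All using (All; []; _∷_)
import Data.List.Relation.Unary.All as All
open import Data.List.Relation.Binary.Pointwise using (Pointwise; []; _∷_; Pointwise-length)
import Data.List.Relation.Binary.Pointwise as Pointwise
open import Data.Product using (_×_; _,_; proj₁; proj₂; Σ)
open import Data.Sum using (_⊎_; inj₁; inj₂)
open import Data.Maybe using (Maybe; just; nothing)
open import Data.Empty using (⊥; ⊥-elim)
open import Data.Unit using (⊤; tt)
open import Function.Bundles using (Equivalence)
open import Relation.Nullary using (¬_; yes; no; Dec)
open import Relation.Binary using (tri<; tri≈; tri>)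
open import Relation.Binary.PropositionalEquality hiding ([_])

at-beyond : ∀ r j → length r < j → at r j ≡ 0
at-beyond r zero _ = refl
at-beyond [] (suc j) _ = refl
at-beyond (x ∷ r) (suc (suc j)) (s≤s p) = at-beyond r (suc j) p

length-setAt : ∀ r j v → length (setAt r j v) ≡ length r
length-setAt r zero v = refl
length-setAt [] (suc j) v = refl
length-setAt (x ∷ r) (suc zero) v = refl
length-setAt (x ∷ r) (suc (suc j)) v = cong suc (length-setAt r (suc j) v)

at-setAt-same : ∀ r j v → 1 ≤ j → j ≤ length r → at (setAt r j v) j ≡ v
at-setAt-same (x ∷ r) (suc zero) v _ _ = refl
at-setAt-same (x ∷ r) (suc (suc j)) v _ (s≤s p) = at-setAt-same r (suc j) v (s≤s z≤n) p

at-setAt-other : ∀ r j j′ v → j′ ≢ j → at (setAt r j v) j′ ≡ at r j′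
at-setAt-other r j zero v _ = refl
at-setAt-other r zero (suc j′) v _ = refl
at-setAt-other [] (suc j) (suc j′) v _ = refl
at-setAt-other (x ∷ r) (suc zero) (suc zero) v ne = ⊥-elim (ne refl)
at-setAt-other (x ∷ r) (suc zero) (suc (suc j′)) v ne = refl
at-setAt-other (x ∷ r) (suc (suc j)) (suc zero) v ne = refl
at-setAt-other (x ∷ r) (suc (suc j)) (suc (suc j′)) v ne =
  at-setAt-other r (suc j) (suc j′) v (λ e → ne (cong suc e))

length-snoc : ∀ (r : List ℕ) v → length (r ++ [ v ]) ≡ suc (length r)
length-snoc r v = trans (length-++ r) (+-comm (length r) 1)

at-snoc-old : ∀ r v j → j ≤ length r → at (r ++ [ v ]) j ≡ at r j
at-snoc-old r v zero _ = refl
at-snoc-old (x ∷ r) v (suc zero) _ = refl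
at-snoc-old (x ∷ r) v (suc (suc j)) (s≤s p) = at-snoc-old r v (suc j) p

at-snoc-new : ∀ r v → at (r ++ [ v ]) (suc (length r)) ≡ v
at-snoc-new [] v = refl
at-snoc-new (x ∷ []) v = refl
at-snoc-new (x ∷ y ∷ r) v = at-snoc-new (y ∷ r) v

N≤L⇒L≰N∸1 : ∀ {N L} → 1 ≤ N → N ≤ L → L ≤ N ∸ 1 → ⊥
N≤L⇒L≰N∸1 {suc n} _ a b = 1+n≰n (≤-trans a b)

byColumn : ∀ N (P : ℕ → Set) → (∀ j → j < N → P j) → P N → (∀ j → N < j → P j) → ∀ j → P j
byColumn N P left here right j with <-cmp j N
... | tri< j<N _ _ = left j j<N
... | tri≈ _ refl _ = here
... | tri> _ _ N<j = right j N<j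

trueT : ∀ {b} → b ≡ true → T b
trueT refl = tt

falseT : ∀ {b} → b ≡ false → ¬ T b
falseT refl ()

≡ᵇ-refl : ∀ n → (n ≡ᵇ n) ≡ true
≡ᵇ-refl n = Equivalence.to T-≡ (≡⇒≡ᵇ n n refl)

≡ᵇ-≢ : ∀ m n → m ≢ n → (m ≡ᵇ n) ≡ false
≡ᵇ-≢ m n ne with m ≡ᵇ n in e
... | true = ⊥-elim (ne (≡ᵇ⇒≡ m n (trueT e)))
... | false = refl

<ᵇ-true : ∀ {m n} → m < n → (m <ᵇ n) ≡ true
<ᵇ-true lt = Equivalence.to T-≡ (<⇒<ᵇ lt)

<ᵇ-false : ∀ {m n} → n ≤ m → (m <ᵇ n) ≡ false
<ᵇ-false {m} {n} le with m <ᵇ n in e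
... | true = ⊥-elim (<⇒≱ (<ᵇ⇒< m n (trueT e)) le)
... | false = refl

if-true : ∀ (b : Bool) (x : ℕ) → T b → (if b then x else 0) ≡ x
if-true true x _ = refl

if-mono : ∀ (b c : Bool) (x y : ℕ) → (T b → T c) → x ≤ y → (if b then x else 0) ≤ (if c then y else 0)
if-mono false c x y _ _ = z≤n
if-mono true true x y _ le = le
if-mono true false x y f _ = ⊥-elim (f tt)

if-positive : ∀ (b : Bool) (x : ℕ) → 0 < (if b then x else 0) → T b
if-positive true x _ = tt

data RowStepView (j h : ℕ) (r : List ℕ) : RowRes → Set where
  placedV : length r ≡ j ∸ 1 → h < at r (j ∸ 1) → RowStepView j h r (placed (r ++ [ h ]))
  bumpedV : j ≤ length r → at r j ≤ h → h < at r (j ∸ 1) →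
            RowStepView j h r (bumped (setAt r j h) (at r j))
  skipV   : ¬ (length r ≡ j ∸ 1 × h < at r (j ∸ 1)) →
            ¬ (j ≤ length r × at r j ≤ h × h < at r (j ∸ 1)) → RowStepView j h r skip

rowStepView : ∀ j h r → RowStepView j h r (rowStep j h r)
rowStepView j h r with (length r ≡ᵇ (j ∸ 1)) ∧ (h <ᵇ at r (j ∸ 1)) in placeTest
... | true = let (l , lt) = Equivalence.to T-∧ (trueT placeTest)
             in placedV (≡ᵇ⇒≡ _ _ l) (<ᵇ⇒< _ _ lt)
... | false with (j ≤ᵇ length r) ∧ ((at r j ≤ᵇ h) ∧ (h <ᵇ at r (j ∸ 1))) in bumpTest
...   | true = let (l , rest) = Equivalence.to T-∧ (trueT bumpTest)
                   (q , lt) = Equivalence.to T-∧ rest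
               in bumpedV (≤ᵇ⇒≤ _ _ l) (≤ᵇ⇒≤ _ _ q) (<ᵇ⇒< _ _ lt)
...   | false =
  skipV (λ (l , lt) → falseT placeTest (Equivalence.from T-∧ (≡⇒≡ᵇ _ _ l , <⇒<ᵇ lt)))
        (λ (l , q , lt) → falseT bumpTest
           (Equivalence.from T-∧ (≤⇒≤ᵇ l , Equivalence.from T-∧ (≤⇒≤ᵇ q , <⇒<ᵇ lt))))

leftNeighbour : ∀ r j h → h < at r (j ∸ 1) → 1 ≤ j ∸ 1
leftNeighbour r (suc (suc j)) h _ = s≤s z≤n

colTab : ColRes → Tab
colTab (cstop T i) = T
colTab (cgo T h) = T

colOut : ColRes → ℕ
colOut (cstop T i) = 0
colOut (cgo T h) = h

data Continues : ColRes → Set where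
  cgo : ∀ T h → Continues (cgo T h)

colTab-consRow : ∀ r X → colTab (consRow r X) ≡ r ∷ colTab X
colTab-consRow r (cstop T i) = refl
colTab-consRow r (cgo T h) = refl

colOut-consRow : ∀ r X → colOut (consRow r X) ≡ colOut X
colOut-consRow r (cstop T i) = refl
colOut-consRow r (cgo T h) = refl

Continues-consRow⁻ : ∀ r X → Continues (consRow r X) → Continues X
Continues-consRow⁻ r (cgo T h) _ = cgo T h

Continues-consRow⁺ : ∀ r X → Continues X → Continues (consRow r X)
Continues-consRow⁺ r (cgo T h) _ = cgo (r ∷ T) h

consRow-stop⁻ : ∀ r X T′ i₀ → consRow r X ≡ cstop T′ i₀ →
  Σ Tab λ T″ → Σ ℕ λ i₁ → X ≡ cstop T″ i₁ × i₀ ≡ suc i₁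
consRow-stop⁻ r (cstop T i) .(r ∷ T) .(suc i) refl = T , i , refl , refl

consRow-go⁻ : ∀ r X T′ h′ → consRow r X ≡ cgo T′ h′ → Σ Tab λ T″ → X ≡ cgo T″ h′ × T′ ≡ r ∷ T″
consRow-go⁻ r (cgo T h) .(r ∷ T) .h refl = T , refl , refl

stop≢go : ∀ {T i T′ h} → cstop T i ≢ cgo T′ h
stop≢go ()

cstop-row : ∀ {T i T′ i′} → cstop T i ≡ cstop T′ i′ → i ≡ i′
cstop-row refl = refl

scanColAfter : ℕ → ℕ → List ℕ → Tab → RowRes → ColRes
scanColAfter j h r T (placed r′) = cstop (r′ ∷ T) 1
scanColAfter j h r T (bumped r′ h′) = consRow r′ (scanCol j h′ T)
scanColAfter j h r T skip = consRow r (scanCol j h T)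

scanCol-cons : ∀ j h r T X → rowStep j h r ≡ X → scanCol j h (r ∷ T) ≡ scanColAfter j h r T X
scanCol-cons j h r T X eq with rowStep j h r
scanCol-cons j h r T .(placed _) refl | placed _ = refl
scanCol-cons j h r T .(bumped _ _) refl | bumped _ _ = refl
scanCol-cons j h r T .skip refl | skip = refl

colHandAfter : ℕ → ℕ → Tab → ℕ → RowRes → ℕ
colHandAfter j h T i (placed _) = 0
colHandAfter j h T i (bumped _ h′) = colHand′ j h′ T i
colHandAfter j h T i skip = colHand′ j h T i

colHand′-cons : ∀ j h r T i X → rowStep j h r ≡ X → colHand′ j h (r ∷ T) (suc i) ≡ colHandAfter j h T i X
colHand′-cons j h r T i X eq with rowStep j h r
colHand′-cons j h r T i .(placed _) refl | placed _ = refl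
colHand′-cons j h r T i .(bumped _ _) refl | bumped _ _ = refl
colHand′-cons j h r T i .skip refl | skip = refl

colHand′-[] : ∀ j h i → colHand′ j h [] i ≡ h
colHand′-[] j h zero = refl
colHand′-[] j h (suc i) = refl

-- The entry in hand only decreases while scanning down a column (bumped
-- entries are ≤ the entry that bumps them).

colHand′-≤ : ∀ j h T i → colHand′ j h T i ≤ h
colHand′-≤ j h T zero = ≤-refl
colHand′-≤ j h [] (suc i) = ≤-refl
colHand′-≤ j h (r ∷ T) (suc i) with rowStep j h r | rowStepView j h r
... | .(placed _) | placedV _ _ = z≤n
... | .(bumped _ _) | bumpedV _ q≤h _ = ≤-trans (colHand′-≤ j _ T i) q≤h
... | .skip | skipV _ _ = colHand′-≤ j h T i

colHand-≤ : ∀ j h T i → colHand j h T i ≤ h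
colHand-≤ j h T zero = ≤-refl
colHand-≤ j h T (suc i) = colHand′-≤ j h T i

colOut-≤ : ∀ j h T → colOut (scanCol j h T) ≤ h
colOut-≤ j h [] = ≤-refl
colOut-≤ j h (r ∷ T) with rowStep j h r | rowStepView j h r
... | .(placed _) | placedV _ _ = z≤n
... | .(bumped _ _) | bumpedV _ q≤h _ rewrite colOut-consRow (setAt r j h) (scanCol j (at r j) T) =
  ≤-trans (colOut-≤ j _ T) q≤h
... | .skip | skipV _ _ rewrite colOut-consRow r (scanCol j h T) = colOut-≤ j h T

colOut-≤-colHand′ : ∀ j h T i → colOut (scanCol j h T) ≤ colHand′ j h T i
colOut-≤-colHand′ j h T zero = colOut-≤ j h T
colOut-≤-colHand′ j h [] (suc i) = ≤-refl
colOut-≤-colHand′ j h (r ∷ T) (suc i) with rowStep j h r | rowStepView j h r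
... | .(placed _) | placedV _ _ = z≤n
... | .(bumped _ _) | bumpedV _ _ _ rewrite colOut-consRow (setAt r j h) (scanCol j (at r j) T) =
  colOut-≤-colHand′ j _ T i
... | .skip | skipV _ _ rewrite colOut-consRow r (scanCol j h T) = colOut-≤-colHand′ j h T i

stopRow-positive : ∀ j h T T′ i₀ → scanCol j h T ≡ cstop T′ i₀ → 1 ≤ i₀
stopRow-positive j h (r ∷ T) T′ i₀ eq with rowStep j h r | rowStepView j h r
... | .(placed _) | placedV _ _ with eq
...   | refl = s≤s z≤n
stopRow-positive j h (r ∷ T) T′ i₀ eq | .(bumped _ _) | bumpedV _ _ _ with consRow-stop⁻ _ _ _ _ eq
... | _ , _ , _ , refl = s≤s z≤n
stopRow-positive j h (r ∷ T) T′ i₀ eq | .skip | skipV _ _ with consRow-stop⁻ _ _ _ _ eq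
... | _ , _ , _ , refl = s≤s z≤n

colHand′-afterStop : ∀ j h T T′ i₀ i → scanCol j h T ≡ cstop T′ i₀ → i₀ ≤ i → colHand′ j h T i ≡ 0
colHand′-afterStop j h T T′ i₀ zero eq le with ≤-trans (stopRow-positive j h T T′ i₀ eq) le
... | ()
colHand′-afterStop j h (r ∷ T) T′ i₀ (suc i) eq le with rowStep j h r | rowStepView j h r
... | .(placed _) | placedV _ _ = refl
... | .(bumped _ _) | bumpedV _ _ _ with consRow-stop⁻ _ _ _ _ eq
...   | T″ , i₁ , e , refl = colHand′-afterStop j _ T T″ i₁ i e (≤-pred le)
colHand′-afterStop j h (r ∷ T) T′ i₀ (suc i) eq le | .skip | skipV _ _ with consRow-stop⁻ _ _ _ _ eq
... | T″ , i₁ , e , refl = colHand′-afterStop j h T T″ i₁ i e (≤-pred le)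

colHand′-belowColumn : ∀ j h T T′ h′ i → scanCol j h T ≡ cgo T′ h′ → length T ≤ i → colHand′ j h T i ≡ h′
colHand′-belowColumn j h [] T′ h′ i refl le = colHand′-[] j h i
colHand′-belowColumn j h (r ∷ T) T′ h′ (suc i) eq (s≤s le) with rowStep j h r | rowStepView j h r
... | .(placed _) | placedV _ _ = ⊥-elim (stop≢go eq)
... | .(bumped _ _) | bumpedV _ _ _ = let (T″ , e , _) = consRow-go⁻ _ _ _ _ eq in colHand′-belowColumn j _ T T″ h′ i e le
... | .skip | skipV _ _ = let (T″ , e , _) = consRow-go⁻ _ _ _ _ eq in colHand′-belowColumn j h T T″ h′ i e le

colTab-length : ∀ j h T → length (colTab (scanCol j h T)) ≡ length T
colTab-length j h [] = refl
colTab-length j h (r ∷ T) with rowStep j h r | rowStepView j h r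
... | .(placed _) | placedV _ _ = refl
... | .(bumped _ _) | bumpedV _ _ _ rewrite colTab-consRow (setAt r j h) (scanCol j (at r j) T) =
  cong suc (colTab-length j _ T)
... | .skip | skipV _ _ rewrite colTab-consRow r (scanCol j h T) = cong suc (colTab-length j h T)

-- Scanning column N with an entry ≤ h in hand
-- changes a row only in column N, to a value ≤ h, possibly appending a box
-- in column N.  Scanning columns n, n-1, …, 2 with entries ≤ h in hand
-- changes only columns ≤ n, always to values ≤ h, and appends at most one
-- box, in a column ≤ n.

ColumnChange : ℕ → ℕ → List ℕ → List ℕ → Set
ColumnChange N h r r₁ =
  (∀ j → j ≢ N → at r₁ j ≡ at r j) × (at r₁ N ≡ at r N ⊎ at r₁ N ≤ h) ×
  (length r₁ ≡ length r ⊎ (length r₁ ≡ suc (length r) × length r₁ ≡ N))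

LengthRel : ℕ → List ℕ → List ℕ → Set
LengthRel N r r′ = length r′ ≡ length r ⊎ (length r′ ≡ suc (length r) × length r′ ≤ N ∸ 1)

ChangedUpTo : ℕ → ℕ → List ℕ → List ℕ → Set
ChangedUpTo n h r r″ =
  (∀ j → n < j → at r″ j ≡ at r j) × (∀ j → at r″ j ≡ at r j ⊎ at r″ j ≤ h) ×
  LengthRel (suc n) r r″

ColumnChange-refl : ∀ {N h r} → ColumnChange N h r r
ColumnChange-refl = (λ j _ → refl) , inj₁ refl , inj₁ refl

ChangedUpTo-refl : ∀ {n h r} → ChangedUpTo n h r r
ChangedUpTo-refl = (λ j _ → refl) , (λ j → inj₁ refl) , inj₁ refl

ColumnChange⇒ChangedUpTo : ∀ {N h r r₁} → ColumnChange N h r r₁ → ChangedUpTo N h r r₁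
ColumnChange⇒ChangedUpTo {N} {h} {r} {r₁} (same , inN , len) = above , anyCol , len′ len
  where
  above : ∀ j → N < j → at r₁ j ≡ at r j
  above j lt = same j (>⇒≢ lt)
  anyCol : ∀ j → at r₁ j ≡ at r j ⊎ at r₁ j ≤ h
  anyCol j with j ≟ N
  ... | yes refl = inN
  ... | no ne = inj₁ (same j ne)
  len′ : (length r₁ ≡ length r ⊎ (length r₁ ≡ suc (length r) × length r₁ ≡ N)) →
         (length r₁ ≡ length r ⊎ (length r₁ ≡ suc (length r) × length r₁ ≤ N))
  len′ (inj₁ e) = inj₁ e
  len′ (inj₂ (e , e′)) = inj₂ (e , ≤-reflexive e′)

ChangedUpTo-step : ∀ {n x h r r₁ r″} → h ≤ x → ColumnChange (suc n) x r r₁ → ChangedUpTo n h r₁ r″ →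
                   ChangedUpTo (suc n) x r r″
ChangedUpTo-step {n} {x} {h} {r} {r₁} {r″} h≤x (same , inN , len) (above′ , anyCol′ , len′) =
  above , (λ j → anyCol j (anyCol′ j) (j ≟ suc n)) , length′ len len′
  where
  above : ∀ j → suc n < j → at r″ j ≡ at r j
  above j lt = trans (above′ j (≤-trans (n≤1+n _) lt)) (same j (>⇒≢ lt))
  anyCol : ∀ j → (at r″ j ≡ at r₁ j ⊎ at r″ j ≤ h) → Dec (j ≡ suc n) → at r″ j ≡ at r j ⊎ at r″ j ≤ x
  anyCol j (inj₂ le) _ = inj₂ (≤-trans le h≤x)
  anyCol j (inj₁ e) (no ne) = inj₁ (trans e (same j ne))
  anyCol j (inj₁ e) (yes refl) = fromColumn inN
    where
    fromColumn : at r₁ (suc n) ≡ at r (suc n) ⊎ at r₁ (suc n) ≤ x → at r″ (suc n) ≡ at r (suc n) ⊎ at r″ (suc n) ≤ x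
    fromColumn (inj₁ e′) = inj₁ (trans e e′)
    fromColumn (inj₂ le) = inj₂ (subst (_≤ x) (sym e) le)
  length′ : (length r₁ ≡ length r ⊎ (length r₁ ≡ suc (length r) × length r₁ ≡ suc n)) →
            (length r″ ≡ length r₁ ⊎ (length r″ ≡ suc (length r₁) × length r″ ≤ n)) →
            length r″ ≡ length r ⊎ (length r″ ≡ suc (length r) × length r″ ≤ suc n)
  length′ (inj₁ e) (inj₁ e′) = inj₁ (trans e′ e)
  length′ (inj₁ e) (inj₂ (e′ , le′)) = inj₂ (trans e′ (cong suc e) , ≤-trans le′ (n≤1+n _))
  length′ (inj₂ (e , le)) (inj₁ e′) = inj₂ (trans e′ e , ≤-reflexive (trans e′ le))
  length′ (inj₂ (e , le)) (inj₂ (e′ , le′)) =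
    ⊥-elim (1+n≰n (≤-trans (n≤1+n (suc n)) (subst (_≤ n) (trans e′ (cong suc le)) le′)))

scanCol-columnChange : ∀ N h h′ T → h′ ≤ h → Pointwise (ColumnChange N h) T (colTab (scanCol N h′ T))
scanCol-columnChange N h h′ [] _ = []
scanCol-columnChange N h h′ (r ∷ T) h′≤h with rowStep N h′ r | rowStepView N h′ r
... | .(placed _) | placedV len lt = placeChange ∷ Pointwise.refl ColumnChange-refl
  where
  newLength : suc (length r) ≡ N
  newLength = trans (cong suc len) (m+[n∸m]≡n {1} {N} (≤-trans (leftNeighbour r N h′ lt) (m∸n≤m N 1)))
  lengthAfter : length (r ++ [ h′ ]) ≡ N
  lengthAfter = trans (length-snoc r h′) newLength
  unchanged : ∀ j → j ≢ N → at (r ++ [ h′ ]) j ≡ at r j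
  unchanged j ne with j ≤? length r
  ... | yes p = at-snoc-old r h′ j p
  ... | no p = trans (at-beyond (r ++ [ h′ ]) j
                        (subst (_< j) (sym lengthAfter) (≤∧≢⇒< (subst (_≤ j) newLength (≰⇒> p)) (≢-sym ne))))
                     (sym (at-beyond r j (≰⇒> p)))
  placeChange : ColumnChange N h r (r ++ [ h′ ])
  placeChange = unchanged
              , inj₂ (subst (_≤ h) (sym (subst (λ z → at (r ++ [ h′ ]) z ≡ h′) newLength (at-snoc-new r h′))) h′≤h)
              , inj₂ (length-snoc r h′ , lengthAfter)
... | .(bumped _ _) | bumpedV N≤L q≤h′ lt rewrite colTab-consRow (setAt r N h′) (scanCol N (at r N) T) =
  ( (λ j ne → at-setAt-other r N j h′ ne)
  , inj₂ (subst (_≤ h) (sym (at-setAt-same r N h′ N1 N≤L)) h′≤h)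
  , inj₁ (length-setAt r N h′))
  ∷ scanCol-columnChange N h (at r N) T (≤-trans q≤h′ h′≤h)
  where
  N1 : 1 ≤ N
  N1 = ≤-trans (leftNeighbour r N h′ lt) (m∸n≤m N 1)
... | .skip | skipV _ _ rewrite colTab-consRow r (scanCol N h′ T) =
  ColumnChange-refl ∷ scanCol-columnChange N h h′ T h′≤h

-- The shape of an insertion.  Inserting x into T from column N first scans
-- columns N, N-1, …, 2, producing a filling V; if the insertion has not
-- stopped by then, it ends by adding a new one-box row [y] after row p.
-- scanColumns records V and the optional new row (p , y).

-- the optional new one-box row: after row p, with entry y
NewRow : Set
NewRow = Maybe (ℕ × ℕ)

addRow : NewRow → Tab → Tab
addRow nothing V = V
addRow (just (p , y)) V = newRowAfter p y V

scanColumns : ℕ → ℕ → Tab → NewRow × Tab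
scanColumnsAfter : ℕ → ColRes → NewRow × Tab
scanColumns zero x T = nothing , T
scanColumns (suc zero) x T = just (lowestLe x T , x) , T
scanColumns (suc (suc n)) x T = scanColumnsAfter (suc n) (scanCol (suc (suc n)) x T)
scanColumnsAfter n (cstop T′ i) = nothing , T′
scanColumnsAfter n (cgo T′ h) = scanColumns n h T′

insertion-decomposes : ∀ n x T →
  InsResult.tab (insertFrom (suc n) x T) ≡ addRow (proj₁ (scanColumns (suc n) x T)) (proj₂ (scanColumns (suc n) x T))
insertion-decomposes zero x T = refl
insertion-decomposes (suc n) x T with scanCol (suc (suc n)) x T
... | cstop T′ i = refl
... | cgo T′ h = insertion-decomposes n h T′

scanColumns-changes : ∀ n x T → Pointwise (ChangedUpTo (suc n) x) T (proj₂ (scanColumns (suc n) x T))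
scanColumns-changes zero x T = Pointwise.refl ChangedUpTo-refl
scanColumns-changes (suc n) x T
  with scanCol (suc (suc n)) x T | scanCol-columnChange (suc (suc n)) x x T ≤-refl | colOut-≤ (suc (suc n)) x T
... | cstop T′ i | change | _ = Pointwise.map ColumnChange⇒ChangedUpTo change
... | cgo T′ h | change | h≤x =
  Pointwise.transitive (ChangedUpTo-step h≤x) change (scanColumns-changes n h T′)

lowestLe-≤ : ∀ x T → lowestLe x T ≤ length T
lowestLe-≤ x [] = z≤n
lowestLe-≤ x (r ∷ T) with lowestLe x T | lowestLe-≤ x T
... | zero | _ with at r 1 ≤ᵇ x
...   | true = s≤s z≤n
...   | false = z≤n
lowestLe-≤ x (r ∷ T) | suc n | le = s≤s le

lowestLe-≥ : ∀ x T i → 1 ≤ i → i ≤ length T → at (rowAt T i) 1 ≤ x → i ≤ lowestLe x T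
lowestLe-≥ x (r ∷ T) (suc zero) _ _ le with lowestLe x T
... | zero rewrite Equivalence.to T-≡ (≤⇒≤ᵇ le) = ≤-refl
... | suc n = s≤s z≤n
lowestLe-≥ x (r ∷ T) (suc (suc i)) _ (s≤s il) le with lowestLe x T | lowestLe-≥ x T (suc i) (s≤s z≤n) il le
... | suc n | s≤s k = s≤s (s≤s k)

newRow-bounds : ∀ n x T p y → proj₁ (scanColumns (suc n) x T) ≡ just (p , y) → y ≤ x × p ≤ length T
newRow-bounds zero x T .(lowestLe x T) .x refl = ≤-refl , lowestLe-≤ x T
newRow-bounds (suc n) x T p y e with scanCol (suc (suc n)) x T in eq
... | cgo T′ h =
  let (y≤h , p≤) = newRow-bounds n h T′ p y e
      h≤x = subst (λ X → colOut X ≤ x) eq (colOut-≤ (suc (suc n)) x T)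
      sameLength = subst (λ X → length (colTab X) ≡ length T) eq (colTab-length (suc (suc n)) x T)
  in ≤-trans y≤h h≤x , subst (p ≤_) sameLength p≤

length-newRowAfter : ∀ p x T → length (newRowAfter p x T) ≡ suc (length T)
length-newRowAfter zero x T = refl
length-newRowAfter (suc p) x [] = refl
length-newRowAfter (suc p) x (r ∷ T) = cong suc (length-newRowAfter p x T)

rowAt-newRowAfter : ∀ p x T → p ≤ length T → rowAt (newRowAfter p x T) (suc p) ≡ [ x ]
rowAt-newRowAfter zero x T _ = refl
rowAt-newRowAfter (suc p) x (r ∷ T) (s≤s le) = rowAt-newRowAfter p x T le

stopCol stopRow : ℕ → ℕ → Tab → ℕ
stopCol N x T = InsResult.stopC (insertFrom N x T)
stopRow N x T = InsResult.stopR (insertFrom N x T)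

hands : ℕ → ℕ → Tab → ℕ → ℕ → ℕ
hands N x T = InsResult.hand (insertFrom N x T)

data StopKind (N : ℕ) : NewRow → ℕ → ℕ → Set where
  inColumn : ∀ {j i} → 2 ≤ j → j ≤ N → StopKind N nothing j i
  inNewRow : ∀ p y → StopKind N (just (p , y)) 1 (suc p)

stopKind : ∀ n x T → StopKind (suc n) (proj₁ (scanColumns (suc n) x T)) (stopCol (suc n) x T) (stopRow (suc n) x T)
stopKind zero x T = inNewRow (lowestLe x T) x
stopKind (suc n) x T with scanCol (suc (suc n)) x T
... | cstop T′ i = inColumn (s≤s (s≤s z≤n)) ≤-refl
... | cgo T′ h = StopKind-weaken (stopKind n h T′)
  where
  StopKind-weaken : ∀ {N s j i} → StopKind N s j i → StopKind (suc N) s j i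
  StopKind-weaken (inColumn j2 j≤) = inColumn j2 (≤-trans j≤ (n≤1+n _))
  StopKind-weaken (inNewRow p y) = inNewRow p y

stopCol-≤ : ∀ n x T → stopCol (suc n) x T ≤ suc n
stopCol-≤ n x T = column≤ (stopKind n x T)
  where
  column≤ : ∀ {s j i} → StopKind (suc n) s j i → j ≤ suc n
  column≤ (inColumn _ j≤) = j≤
  column≤ (inNewRow _ _) = s≤s z≤n

stop-inColumn : ∀ n x T T′ i₀ → scanCol (suc (suc n)) x T ≡ cstop T′ i₀ →
                stopCol (suc (suc n)) x T ≡ suc (suc n) × stopRow (suc (suc n)) x T ≡ i₀
stop-inColumn n x T T′ i₀ eq with scanCol (suc (suc n)) x T
stop-inColumn n x T T′ i₀ refl | .(cstop T′ i₀) = refl , refl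

stop-later : ∀ n x T T′ h → scanCol (suc (suc n)) x T ≡ cgo T′ h →
             stopCol (suc (suc n)) x T ≡ stopCol (suc n) h T′ × stopRow (suc (suc n)) x T ≡ stopRow (suc n) h T′
stop-later n x T T′ h eq with scanCol (suc (suc n)) x T
stop-later n x T T′ h refl | .(cgo T′ h) = refl , refl

hands-startCol : ∀ N x T i → 2 ≤ N → hands N x T i N ≡ colHand N x T i
hands-startCol (suc zero) x T i (s≤s ())
hands-startCol (suc (suc n)) x T i _ with scanCol (suc (suc n)) x T in eq
... | cgo T′ h rewrite ≡ᵇ-refl (suc (suc n)) = refl
... | cstop T′ i₀ rewrite ≡ᵇ-refl (suc (suc n)) with i ≤ᵇ i₀ in below
...   | true = refl
...   | false with i
...     | zero = ⊥-elim (falseT below tt)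
...     | suc i′ = sym (colHand′-afterStop _ x T T′ i₀ i′ eq (≤-pred (≰⇒> (λ le → falseT below (≤⇒≤ᵇ le)))))

hands-beyond : ∀ N x T i j → N < j → hands N x T i j ≡ 0
hands-beyond zero x T i j _ = refl
hands-beyond (suc zero) x T i j lt rewrite ≡ᵇ-≢ j 1 (>⇒≢ lt) = refl
hands-beyond (suc (suc n)) x T i j lt with scanCol (suc (suc n)) x T
... | cstop T′ i₀ rewrite ≡ᵇ-≢ j (suc (suc n)) (>⇒≢ lt) = refl
... | cgo T′ h rewrite ≡ᵇ-≢ j (suc (suc n)) (>⇒≢ lt) | <ᵇ-false {j} {suc (suc n)} (<⇒≤ lt) = refl

hands-continue : ∀ n x T T′ h i j → scanCol (suc (suc n)) x T ≡ cgo T′ h → j < suc (suc n) →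
                 hands (suc (suc n)) x T i j ≡ hands (suc n) h T′ i j
hands-continue n x T T′ h i j eq lt with scanCol (suc (suc n)) x T
hands-continue n x T T′ h i j refl lt | .(cgo T′ h)
  rewrite ≡ᵇ-≢ j (suc (suc n)) (<⇒≢ lt) | <ᵇ-true lt = refl

hands-stopped : ∀ n x T T′ i₀ i j → scanCol (suc (suc n)) x T ≡ cstop T′ i₀ → j < suc (suc n) →
                hands (suc (suc n)) x T i j ≡ 0
hands-stopped n x T T′ i₀ i j eq lt with scanCol (suc (suc n)) x T
hands-stopped n x T T′ i₀ i j refl lt | .(cstop T′ i₀)
  rewrite ≡ᵇ-≢ j (suc (suc n)) (<⇒≢ lt) = refl

-- Rows with positive, strictly decreasing entries (the only properties of a
-- row-strict composition tableau that the comparison needs).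

PosDecreasing : List ℕ → Set
PosDecreasing r = (∀ j → 1 ≤ j → j ≤ length r → 0 < at r j) ×
                  (∀ j → 1 ≤ j → suc j ≤ length r → at r (suc j) < at r j)

PosDecreasing-bump : ∀ r N h → 2 ≤ N → PosDecreasing r → N ≤ length r → at r N ≤ h → h < at r (N ∸ 1) →
                     PosDecreasing (setAt r N h)
PosDecreasing-bump r N h N2 (pos , dec) N≤L q≤h h<p = pos′ , dec′
  where
  N1 = <⇒≤ N2
  sameLength = length-setAt r N h
  pos′ : ∀ j → 1 ≤ j → j ≤ length (setAt r N h) → 0 < at (setAt r N h) j
  pos′ j j1 jl with j ≟ N
  ... | yes refl = subst (0 <_) (sym (at-setAt-same r N h N1 N≤L)) (≤-trans (pos N N1 N≤L) q≤h)
  ... | no ne = subst (0 <_) (sym (at-setAt-other r N j h ne)) (pos j j1 (subst (j ≤_) sameLength jl))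
  dec′ : ∀ j → 1 ≤ j → suc j ≤ length (setAt r N h) → at (setAt r N h) (suc j) < at (setAt r N h) j
  dec′ j j1 jl with j ≟ N | suc j ≟ N
  ... | yes refl | _ =
    subst₂ _<_ (sym (at-setAt-other r N (suc N) h (>⇒≢ (n<1+n N)))) (sym (at-setAt-same r N h N1 N≤L))
               (≤-trans (dec N N1 (subst (suc N ≤_) sameLength jl)) q≤h)
  ... | no ne | yes refl =
    subst₂ _<_ (sym (at-setAt-same r (suc j) h N1 N≤L)) (sym (at-setAt-other r (suc j) j h ne)) h<p
  ... | no ne | no ne′ =
    subst₂ _<_ (sym (at-setAt-other r N (suc j) h ne′)) (sym (at-setAt-other r N j h ne))
               (dec j j1 (subst (suc j ≤_) sameLength jl))

colTab-posDecreasing : ∀ N h T T′ h′ → 2 ≤ N → All PosDecreasing T → scanCol N h T ≡ cgo T′ h′ →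
                       All PosDecreasing T′
colTab-posDecreasing N h [] T′ h′ N2 ps refl = []
colTab-posDecreasing N h (r ∷ T) T′ h′ N2 (pr ∷ pT) eq with rowStep N h r | rowStepView N h r
... | .(placed _) | placedV _ _ = ⊥-elim (stop≢go eq)
... | .(bumped _ _) | bumpedV N≤L q≤ lt with consRow-go⁻ _ _ _ _ eq
...   | T″ , e , refl = PosDecreasing-bump r N h N2 pr N≤L q≤ lt ∷ colTab-posDecreasing N _ T T″ h′ N2 pT e
colTab-posDecreasing N h (r ∷ T) T′ h′ N2 (pr ∷ pT) eq | .skip | skipV _ _ with consRow-go⁻ _ _ _ _ eq
... | T″ , e , refl = pr ∷ colTab-posDecreasing N h T T″ h′ N2 pT e

-- bumped entries are entries of the rows, hence positive
colOut-positive : ∀ N h T → 2 ≤ N → 0 < h → All PosDecreasing T → Continues (scanCol N h T) →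
                  0 < colOut (scanCol N h T)
colOut-positive N h [] N2 hp _ _ = hp
colOut-positive N h (r ∷ T) N2 hp (pr ∷ pT) go with rowStep N h r | rowStepView N h r
... | .(placed _) | placedV _ _ with go
...   | ()
colOut-positive N h (r ∷ T) N2 hp (pr ∷ pT) go | .(bumped _ _) | bumpedV N≤L _ _
  rewrite colOut-consRow (setAt r N h) (scanCol N (at r N) T) =
  colOut-positive N (at r N) T N2 (proj₁ pr N (<⇒≤ N2) N≤L) pT (Continues-consRow⁻ _ _ go)
colOut-positive N h (r ∷ T) N2 hp (pr ∷ pT) go | .skip | skipV _ _
  rewrite colOut-consRow r (scanCol N h T) = colOut-positive N h T N2 hp pT (Continues-consRow⁻ _ _ go)

colHand′-positive : ∀ N h T → 2 ≤ N → 0 < h → All PosDecreasing T → ∀ i →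
  0 < colHand′ N h T i ⊎ (Σ Tab λ T′ → Σ ℕ λ i₀ → scanCol N h T ≡ cstop T′ i₀ × i₀ ≤ i)
colHand′-positive N h T N2 hp ps zero = inj₁ hp
colHand′-positive N h [] N2 hp ps (suc i) = inj₁ hp
colHand′-positive N h (r ∷ T) N2 hp (pr ∷ pT) (suc i) with rowStep N h r | rowStepView N h r
... | .(placed _) | placedV _ _ = inj₂ (_ , 1 , refl , s≤s z≤n)
... | .(bumped _ _) | bumpedV N≤L _ _ with colHand′-positive N (at r N) T N2 (proj₁ pr N (<⇒≤ N2) N≤L) pT i
...   | inj₁ p = inj₁ p
...   | inj₂ (T′ , i₀ , e , le) rewrite e = inj₂ (_ , suc i₀ , refl , s≤s le)
colHand′-positive N h (r ∷ T) N2 hp (pr ∷ pT) (suc i) | .skip | skipV _ _ with colHand′-positive N h T N2 hp pT i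
... | inj₁ p = inj₁ p
... | inj₂ (T′ , i₀ , e , le) rewrite e = inj₂ (_ , suc i₀ , refl , s≤s le)

colHand-positive-go : ∀ N h T T′ h′ → 2 ≤ N → 0 < h → All PosDecreasing T → scanCol N h T ≡ cgo T′ h′ →
                      ∀ i → 0 < colHand N h T i
colHand-positive-go N h T T′ h′ N2 hp ps eq zero = hp
colHand-positive-go N h T T′ h′ N2 hp ps eq (suc i) with colHand′-positive N h T N2 hp ps i
... | inj₁ p = p
... | inj₂ (_ , _ , e , _) = ⊥-elim (stop≢go (trans (sym e) eq))

colHand-positive-stop : ∀ N h T T′ i₀ → 2 ≤ N → 0 < h → All PosDecreasing T → scanCol N h T ≡ cstop T′ i₀ →
                        ∀ i → i ≤ i₀ → 0 < colHand N h T i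
colHand-positive-stop N h T T′ i₀ N2 hp ps eq zero _ = hp
colHand-positive-stop N h T T′ i₀ N2 hp ps eq (suc i) i<i₀ with colHand′-positive N h T N2 hp ps i
... | inj₁ p = p
... | inj₂ (_ , i₁ , e , i₁≤i) = ⊥-elim (<⇒≱ i<i₀ (subst (_≤ i) (cstop-row (trans (sym e) eq)) i₁≤i))

hands-positive : ∀ n h T → 0 < h → All PosDecreasing T →
  (∀ i j → stopCol (suc n) h T < j → j ≤ suc n → 0 < hands (suc n) h T i j) ×
  (∀ i → i ≤ stopRow (suc n) h T → 0 < hands (suc n) h T i (stopCol (suc n) h T))
hands-positive zero h T hp ps =
    (λ i j 1<j j≤1 → ⊥-elim (<⇒≱ 1<j j≤1))
  , (λ i i≤ → subst (0 <_) (sym (if-true ((1 ≡ᵇ 1) ∧ (i ≤ᵇ suc (lowestLe h T))) h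
                                          (Equivalence.from T-∧ (tt , ≤⇒≤ᵇ i≤)))) hp)
hands-positive (suc n) h T hp ps = byScan (scanCol N h T) refl
  where
  N = suc (suc n)
  N2 : 2 ≤ N
  N2 = s≤s (s≤s z≤n)
  inStartCol : ∀ {i} → 0 < colHand N h T i → 0 < hands N h T i N
  inStartCol {i} = subst (0 <_) (sym (hands-startCol N h T i N2))
  byScan : ∀ X → scanCol N h T ≡ X →
    (∀ i j → stopCol N h T < j → j ≤ N → 0 < hands N h T i j) ×
    (∀ i → i ≤ stopRow N h T → 0 < hands N h T i (stopCol N h T))
  byScan (cstop T′ i₀) eq =
    let (atCol , atRow) = stop-inColumn n h T T′ i₀ eq in
      (λ i j c<j j≤N → ⊥-elim (<⇒≱ (subst (_< j) atCol c<j) j≤N))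
    , (λ i i≤ → subst (λ j → 0 < hands N h T i j) (sym atCol)
                  (inStartCol (colHand-positive-stop N h T T′ i₀ N2 hp ps eq i (subst (i ≤_) atRow i≤))))
  byScan (cgo T′ h′) eq =
      (λ i j c<j j≤N → leftOfStart i j (subst (_< j) atCol c<j) j≤N)
    , (λ i i≤ → subst (λ j → 0 < hands N h T i j) (sym atCol)
                  (subst (0 <_) (sym (hands-continue n h T T′ h′ i _ eq (s≤s (stopCol-≤ n h′ T′))))
                     (proj₂ rest i (subst (i ≤_) atRow i≤))))
    where
    atCol = proj₁ (stop-later n h T T′ h′ eq)
    atRow = proj₂ (stop-later n h T T′ h′ eq)
    rest = hands-positive n h′ T′
             (subst (λ X → 0 < colOut X) eq (colOut-positive N h T N2 hp ps (subst Continues (sym eq) (cgo T′ h′))))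
             (colTab-posDecreasing N h T T′ h′ N2 ps eq)
    leftOfStart : ∀ i j → stopCol (suc n) h′ T′ < j → j ≤ N → 0 < hands N h T i j
    leftOfStart i = byColumn N (λ j → stopCol (suc n) h′ T′ < j → j ≤ N → 0 < hands N h T i j)
      (λ j j<N c<j _ → subst (0 <_) (sym (hands-continue n h T T′ h′ i j eq j<N)) (proj₁ rest i j c<j (≤-pred j<N)))
      (λ _ _ → inStartCol (colHand-positive-go N h T T′ h′ N2 hp ps eq i))
      (λ j N<j _ j≤N → ⊥-elim (<⇒≱ N<j j≤N))

-- Comparing two scans of the same column.
--
-- Let r₁ be a row of the first insertion just after it
-- scanned column N, and r′ the corresponding row when the second insertion
-- scans (column N or N+1).  In between, only the later scans of the first
-- insertion acted on the row: they left column N (and N+1) alone, changed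
-- column N-1 only to values ≤ H (its outgoing entry), and appended at most
-- one box, in a column ≤ N-1.

LengthRel-long : ∀ {N r r′} → 1 ≤ N → LengthRel N r r′ → N ≤ length r ⊎ N ≤ length r′ → length r′ ≡ length r
LengthRel-long _ (inj₁ e) _ = e
LengthRel-long N1 (inj₂ (e , short)) (inj₁ long) =
  ⊥-elim (N≤L⇒L≰N∸1 N1 (≤-trans long (≤-trans (n≤1+n _) (≤-reflexive (sym e)))) short)
LengthRel-long N1 (inj₂ (_ , short)) (inj₂ long) = ⊥-elim (N≤L⇒L≰N∸1 N1 long short)

-- relation used for the comparison of b with c ≥ b (same column N)
SameColRel : ℕ → ℕ → List ℕ → List ℕ → Set
SameColRel N H r₁ r′ =
  at r′ N ≡ at r₁ N × (at r′ (N ∸ 1) ≡ at r₁ (N ∸ 1) ⊎ at r′ (N ∸ 1) ≤ H) × LengthRel N r₁ r′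

-- relation used for the comparison of b in column N with a < b in column N+1
NextColRel : ℕ → List ℕ → List ℕ → Set
NextColRel N r₁ r′ = at r′ N ≡ at r₁ N × at r′ (suc N) ≡ at r₁ (suc N) × LengthRel N r₁ r′

hands-≤-cons : ∀ {N hb hc r r′ Tb Tc X Y} → rowStep N hb r ≡ X → rowStep N hc r′ ≡ Y → hb ≤ hc →
  (∀ i → colHandAfter N hb Tb i X ≤ colHandAfter N hc Tc i Y) →
  ∀ i → colHand′ N hb (r ∷ Tb) i ≤ colHand′ N hc (r′ ∷ Tc) i
hands-≤-cons eb ec hb≤hc below zero = hb≤hc
hands-≤-cons {N} {hb} {hc} {r} {r′} {Tb} {Tc} eb ec hb≤hc below (suc i) =
  subst₂ _≤_ (sym (colHand′-cons N hb r Tb i _ eb)) (sym (colHand′-cons N hc r′ Tc i _ ec)) (below i)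

hands-<-cons : ∀ {N hb g r r′ Tb Ta X Y} → rowStep N hb r ≡ X → rowStep (suc N) g r′ ≡ Y → g < hb →
  (∀ i → 0 < colHandAfter N hb Tb i X → colHandAfter (suc N) g Ta i Y < colHandAfter N hb Tb i X) →
  ∀ i → 0 < colHand′ N hb (r ∷ Tb) i → colHand′ (suc N) g (r′ ∷ Ta) i < colHand′ N hb (r ∷ Tb) i
hands-<-cons eb ea g<hb below zero _ = g<hb
hands-<-cons {N} {hb} {g} {r} {r′} {Tb} {Ta} eb ea g<hb below (suc i) pos =
  subst₂ _<_ (sym (colHand′-cons (suc N) g r′ Ta i _ ea)) (sym (colHand′-cons N hb r Tb i _ eb))
    (below i (subst (0 <_) (colHand′-cons N hb r Tb i _ eb) pos))

Continues-cons : ∀ {r r′ X Y} → (Continues X → Continues Y) → Continues (consRow r X) → Continues (consRow r′ Y)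
Continues-cons {r} {r′} {X} {Y} passes go = Continues-consRow⁺ r′ Y (passes (Continues-consRow⁻ r X go))

-- if b bumps in r, then r′ reaches column N, so c cannot place in r′
bumpedRow-long : ∀ {N H hb r r′} → 1 ≤ N → N ≤ length r → SameColRel N H (setAt r N hb) r′ → N ≤ length r′
bumpedRow-long {N} {H} {hb} {r} {r′} N1 N≤L (_ , _ , lenRel) =
  subst (N ≤_) (sym (trans (LengthRel-long {N} {setAt r N hb} {r′} N1 lenRel (inj₁ (subst (N ≤_) (sym sameLength) N≤L)))
                           sameLength)) N≤L
  where
  sameLength = length-setAt r N hb

-- the left neighbour seen by c is the one seen by b whenever c could use it
-- (its alternative value is ≤ H ≤ hc)
leftNeighbour-unchanged : ∀ {N H hc r r′} → H ≤ hc → hc < at r′ (N ∸ 1) →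
  (at r′ (N ∸ 1) ≡ at r (N ∸ 1) ⊎ at r′ (N ∸ 1) ≤ H) → at r′ (N ∸ 1) ≡ at r (N ∸ 1)
leftNeighbour-unchanged _ _ (inj₁ e) = e
leftNeighbour-unchanged H≤hc hc<p (inj₂ p≤H) = ⊥-elim (<⇒≱ hc<p (≤-trans p≤H H≤hc))

skippedRow-noPlace : ∀ {N H hb hc r r′} → H ≤ hb → hb ≤ hc → SameColRel N H r r′ →
  ¬ (length r ≡ N ∸ 1 × hb < at r (N ∸ 1)) → ¬ (length r′ ≡ N ∸ 1 × hc < at r′ (N ∸ 1))
skippedRow-noPlace {N} {H} {hb} {hc} {r} {r′} H≤hb hb≤hc (_ , left , lenRel) b-noPlace (short , hc<p) = cannotPlace lenRel
  where
  sameLeft = leftNeighbour-unchanged {N} {H} {hc} {r} {r′} (≤-trans H≤hb hb≤hc) hc<p left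
  cannotPlace : LengthRel N r r′ → ⊥
  cannotPlace (inj₁ e) = b-noPlace (trans (sym e) short , ≤-<-trans hb≤hc (<-≤-trans hc<p (≤-reflexive sameLeft)))
  cannotPlace (inj₂ (e , _)) =
    n≮0 (<-≤-trans hc<p (≤-reflexive (trans sameLeft
          (at-beyond r (N ∸ 1) (subst (length r <_) (trans (sym e) short) (n<1+n _))))))

skippedRow-bumpsLarger : ∀ {N H hb hc r r′} → 1 ≤ N → H ≤ hb → hb ≤ hc → SameColRel N H r r′ →
  ¬ (N ≤ length r × at r N ≤ hb × hb < at r (N ∸ 1)) → N ≤ length r′ → hc < at r′ (N ∸ 1) → hb ≤ at r′ N
skippedRow-bumpsLarger {N} {H} {hb} {hc} {r} {r′} N1 H≤hb hb≤hc (sameN , left , lenRel) b-noBump N≤L′ hc<p =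
  subst (hb ≤_) (sym sameN)
    (≮⇒≥ (λ q<hb → b-noBump (N≤L , <⇒≤ q<hb , ≤-<-trans hb≤hc (<-≤-trans hc<p (≤-reflexive sameLeft)))))
  where
  sameLeft = leftNeighbour-unchanged {N} {H} {hc} {r} {r′} (≤-trans H≤hb hb≤hc) hc<p left
  N≤L = subst (N ≤_) (LengthRel-long {N} {r} {r′} N1 lenRel (inj₂ N≤L′)) N≤L′

columnCompare-≤ : ∀ N → 2 ≤ N → ∀ H hb hc Tb Tc → hb ≤ hc → H ≤ colOut (scanCol N hb Tb) →
  Pointwise (SameColRel N H) (colTab (scanCol N hb Tb)) Tc →
  (∀ i → colHand′ N hb Tb i ≤ colHand′ N hc Tc i) × (Continues (scanCol N hb Tb) → Continues (scanCol N hc Tc))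
columnCompare-≤ N N2 H hb hc [] .[] le _ [] =
  (λ i → subst₂ _≤_ (sym (colHand′-[] N hb i)) (sym (colHand′-[] N hc i)) le) , (λ _ → cgo [] hc)
columnCompare-≤ N N2 H hb hc (r ∷ Tb) Tc le H≤out rel with rowStep N hb r in eb | rowStepView N hb r
... | .(placed _) | placedV _ _ =
  (λ { zero → le ; (suc i) → subst (_≤ _) (sym (colHand′-cons N hb r Tb i _ eb)) z≤n }) , (λ ())
... | .(bumped _ _) | bumpedV N≤L q≤hb _
  rewrite colTab-consRow (setAt r N hb) (scanCol N (at r N) Tb) | colOut-consRow (setAt r N hb) (scanCol N (at r N) Tb)
  with rel
...   | _∷_ {y = r′} {ys = Tc′} related rel′ with rowStep N hc r′ in ec | rowStepView N hc r′
...     | .(placed _) | placedV short _ =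
  ⊥-elim (N≤L⇒L≰N∸1 (<⇒≤ N2) (bumpedRow-long {N} {H} {hb} {r} {r′} (<⇒≤ N2) N≤L related) (≤-reflexive short))
...     | .(bumped _ _) | bumpedV _ _ _ =
  let c-gets-hb = trans (proj₁ related) (at-setAt-same r N hb (<⇒≤ N2) N≤L)
      (below , passes) =
        columnCompare-≤ N N2 H (at r N) (at r′ N) Tb Tc′ (subst (at r N ≤_) (sym c-gets-hb) q≤hb) H≤out rel′
  in hands-≤-cons eb ec le below , Continues-cons passes
...     | .skip | skipV _ _ =
  let (below , passes) = columnCompare-≤ N N2 H (at r N) hc Tb Tc′ (≤-trans q≤hb le) H≤out rel′
  in hands-≤-cons eb ec le below , Continues-cons passes
columnCompare-≤ N N2 H hb hc (r ∷ Tb) Tc le H≤out rel | .skip | skipV b-noPlace b-noBump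
  rewrite colTab-consRow r (scanCol N hb Tb) | colOut-consRow r (scanCol N hb Tb)
  with rel
... | _∷_ {y = r′} {ys = Tc′} related rel′ with rowStep N hc r′ in ec | rowStepView N hc r′
...   | .(placed _) | placedV short hc<p =
  ⊥-elim (skippedRow-noPlace {N} {H} {hb} {hc} {r} {r′} H≤hb le related b-noPlace (short , hc<p))
  where
  H≤hb = ≤-trans H≤out (colOut-≤ N hb Tb)
...   | .(bumped _ _) | bumpedV N≤L′ _ hc<p =
  let hb≤q = skippedRow-bumpsLarger {N} {H} {hb} {hc} {r} {r′} (<⇒≤ N2) (≤-trans H≤out (colOut-≤ N hb Tb)) le related
               b-noBump N≤L′ hc<p
      (below , passes) = columnCompare-≤ N N2 H hb (at r′ N) Tb Tc′ hb≤q H≤out rel′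
  in hands-≤-cons eb ec le below , Continues-cons passes
...   | .skip | skipV _ _ =
  let (below , passes) = columnCompare-≤ N N2 H hb hc Tb Tc′ le H≤out rel′
  in hands-≤-cons eb ec le below , Continues-cons passes

bumpedRow-sameLength : ∀ {N hb r r′} → 1 ≤ N → N ≤ length r → NextColRel N (setAt r N hb) r′ → length r′ ≡ length r
bumpedRow-sameLength {N} {hb} {r} {r′} N1 N≤L (_ , _ , lenRel) =
  trans (LengthRel-long {N} {setAt r N hb} {r′} N1 lenRel (inj₁ (subst (N ≤_) (sym (length-setAt r N hb)) N≤L)))
        (length-setAt r N hb)

bumpedRow-nextEntry : ∀ {N hb r r′} → NextColRel N (setAt r N hb) r′ → at r′ (suc N) ≡ at r (suc N)
bumpedRow-nextEntry {N} {hb} {r} (_ , sameN+1 , _) = trans sameN+1 (at-setAt-other r N (suc N) hb (>⇒≢ (n<1+n N)))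

bumpedRow-bumpsSmaller : ∀ {N hb r r′} → 1 ≤ N → PosDecreasing r → N ≤ length r → NextColRel N (setAt r N hb) r′ →
                         suc N ≤ length r′ → at r′ (suc N) < at r N
bumpedRow-bumpsSmaller {N} {hb} {r} {r′} N1 (_ , decreasing) N≤L related N+1≤L′ =
  subst (_< at r N) (sym (bumpedRow-nextEntry {N} {hb} {r} {r′} related))
    (decreasing N N1 (subst (suc N ≤_) (bumpedRow-sameLength {N} {hb} {r} {r′} N1 N≤L related) N+1≤L′))

bumpedRow-skipsBelow : ∀ {N hb g r r′} → 1 ≤ N → PosDecreasing r → N ≤ length r → NextColRel N (setAt r N hb) r′ →
  g < hb → ¬ (length r′ ≡ suc N ∸ 1 × g < at r′ (suc N ∸ 1)) →
  ¬ (suc N ≤ length r′ × at r′ (suc N) ≤ g × g < at r′ (suc N ∸ 1)) → g < at r N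
bumpedRow-skipsBelow {N} {hb} {g} {r} {r′} N1 (_ , decreasing) N≤L related g<hb a-noPlace a-noBump =
  <-trans (subst (g <_) (bumpedRow-nextEntry {N} {hb} {r} {r′} related)
             (≰⇒> (λ s≤g → a-noBump (subst (suc N ≤_) (sym sameLength) N+1≤L , s≤g , g<hb′))))
          (decreasing N N1 N+1≤L)
  where
  sameLength = bumpedRow-sameLength {N} {hb} {r} {r′} N1 N≤L related
  -- a sees b's entry hb in column N
  g<hb′ : g < at r′ N
  g<hb′ = subst (g <_) (sym (trans (proj₁ related) (at-setAt-same r N hb N1 N≤L))) g<hb
  N+1≤L : suc N ≤ length r
  N+1≤L = ≤∧≢⇒< N≤L (λ e → a-noPlace (trans sameLength (sym e) , g<hb′))

out-cons : ∀ {r X} r′ Y → (Continues X → colOut Y < colOut X) → Continues (consRow r X) →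
           colOut (consRow r′ Y) < colOut X
out-cons {r} {X} r′ Y out go = subst (_< colOut X) (sym (colOut-consRow r′ Y)) (out (Continues-consRow⁻ r X go))

columnCompare-< : ∀ N → 2 ≤ N → ∀ hb g Tb Ta → g < hb → All PosDecreasing Tb →
  Pointwise (NextColRel N) (colTab (scanCol N hb Tb)) Ta →
  (∀ i → 0 < colHand′ N hb Tb i → colHand′ (suc N) g Ta i < colHand′ N hb Tb i) ×
  (Continues (scanCol N hb Tb) → colOut (scanCol (suc N) g Ta) < colOut (scanCol N hb Tb))
columnCompare-< N N2 hb g [] .[] lt _ [] =
  (λ i _ → subst₂ _<_ (sym (colHand′-[] (suc N) g i)) (sym (colHand′-[] N hb i)) lt) , (λ _ → lt)
columnCompare-< N N2 hb g (r ∷ Tb) Ta lt (pr ∷ pTb) rel with rowStep N hb r in eb | rowStepView N hb r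
... | .(placed _) | placedV _ _ =
  (λ { zero _ → lt ; (suc i) pos → ⊥-elim (<-irrefl refl (subst (0 <_) (colHand′-cons N hb r Tb i _ eb) pos)) }) , (λ ())
... | .(bumped _ _) | bumpedV N≤L q≤hb _
  rewrite colTab-consRow (setAt r N hb) (scanCol N (at r N) Tb) | colOut-consRow (setAt r N hb) (scanCol N (at r N) Tb)
  with rel
...   | _∷_ {y = r′} {ys = Ta′} related rel′ with rowStep (suc N) g r′ in ea | rowStepView (suc N) g r′
...     | .(placed _) | placedV _ _ =
  hands-<-cons eb ea lt (λ i pos → pos)
  , (λ go → colOut-positive N (at r N) Tb N2 (proj₁ pr N (<⇒≤ N2) N≤L) pTb (Continues-consRow⁻ _ _ go))
...     | .(bumped _ _) | bumpedV N+1≤L′ _ _ =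
  let s<q = bumpedRow-bumpsSmaller {N} {hb} {r} {r′} (<⇒≤ N2) pr N≤L related N+1≤L′
      (below , out) = columnCompare-< N N2 (at r N) (at r′ (suc N)) Tb Ta′ s<q pTb rel′
  in hands-<-cons eb ea lt below , out-cons _ (scanCol (suc N) (at r′ (suc N)) Ta′) out
...     | .skip | skipV a-noPlace a-noBump =
  let g<q = bumpedRow-skipsBelow {N} {hb} {g} {r} {r′} (<⇒≤ N2) pr N≤L related lt a-noPlace a-noBump
      (below , out) = columnCompare-< N N2 (at r N) g Tb Ta′ g<q pTb rel′
  in hands-<-cons eb ea lt below , out-cons r′ (scanCol (suc N) g Ta′) out
columnCompare-< N N2 hb g (r ∷ Tb) Ta lt (pr ∷ pTb) rel | .skip | skipV _ _
  rewrite colTab-consRow r (scanCol N hb Tb) | colOut-consRow r (scanCol N hb Tb)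
  with rel
... | _∷_ {y = r′} {ys = Ta′} _ rel′ with rowStep (suc N) g r′ in ea | rowStepView (suc N) g r′
...   | .(placed _) | placedV _ _ =
  hands-<-cons eb ea lt (λ i pos → pos)
  , (λ go → colOut-positive N hb Tb N2 (≤-trans (s≤s z≤n) lt) pTb (Continues-consRow⁻ _ _ go))
...   | .(bumped _ _) | bumpedV _ s≤g _ =
  let (below , out) = columnCompare-< N N2 hb (at r′ (suc N)) Tb Ta′ (≤-<-trans s≤g lt) pTb rel′
  in hands-<-cons eb ea lt below , out-cons _ (scanCol (suc N) (at r′ (suc N)) Ta′) out
...   | .skip | skipV _ _ =
  let (below , out) = columnCompare-< N N2 hb g Tb Ta′ lt pTb rel′
  in hands-<-cons eb ea lt below , out-cons r′ (scanCol (suc N) g Ta′) out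

singleton-skip : ∀ N g x → 2 ≤ N → (x ≤ g ⊎ 3 ≤ N) → rowStep N g [ x ] ≡ skip
singleton-skip N g x N2 cond with rowStep N g [ x ] | rowStepView N g [ x ]
... | .(placed _) | placedV len lt = ⊥-elim (cannotPlace N N2 cond len lt)
  where
  cannotPlace : ∀ N → 2 ≤ N → (x ≤ g ⊎ 3 ≤ N) → 1 ≡ N ∸ 1 → g < at [ x ] (N ∸ 1) → ⊥
  cannotPlace (suc (suc zero)) _ (inj₁ x≤g) _ lt = <⇒≱ lt x≤g
  cannotPlace (suc (suc zero)) _ (inj₂ (s≤s (s≤s ()))) _ _
  cannotPlace (suc (suc (suc n))) _ _ () _
... | .(bumped _ _) | bumpedV N≤1 _ _ = ⊥-elim (<⇒≱ N2 N≤1)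
... | .skip | skipV _ _ = refl

record RowInert (j h p x : ℕ) (T : Tab) : Set where
  field
    above  : ∀ i → i ≤ p → colHand′ j h (newRowAfter p x T) i ≡ colHand′ j h T i
    below  : ∀ i → p ≤ i → colHand′ j h (newRowAfter p x T) (suc i) ≡ colHand′ j h T i
    passes : ∀ T′ h′ → scanCol j h T ≡ cgo T′ h′ → scanCol j h (newRowAfter p x T) ≡ cgo (newRowAfter p x T′) h′
    stops  : ∀ T′ i₀ → scanCol j h T ≡ cstop T′ i₀ →
             Σ Tab λ T₂ → Σ ℕ λ i₂ → scanCol j h (newRowAfter p x T) ≡ cstop T₂ i₂

rowInert : ∀ j h p x T → rowStep j (colHand′ j h T p) [ x ] ≡ skip → RowInert j h p x T

rowInert-passThrough : ∀ j h p x r T r₁ h₁ → rowStep j (colHand′ j h₁ T p) [ x ] ≡ skip →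
  (∀ T′ i → colHand′ j h (r ∷ T′) (suc i) ≡ colHand′ j h₁ T′ i) →
  (∀ T′ → scanCol j h (r ∷ T′) ≡ consRow r₁ (scanCol j h₁ T′)) → RowInert j h (suc p) x (r ∷ T)
rowInert-passThrough j h p x r T r₁ h₁ skips handStep scanStep = record
  { above = λ { zero _ → refl
              ; (suc i) (s≤s le) → trans (handStep _ i) (trans (above i le) (sym (handStep T i))) }
  ; below = λ { (suc i) (s≤s le) → trans (handStep _ (suc i)) (trans (below i le) (sym (handStep T i))) }
  ; passes = λ T′ h′ e →
      let (T″ , e′ , eT) = consRow-go⁻ r₁ _ T′ h′ (trans (sym (scanStep T)) e)
      in trans (scanStep _) (trans (cong (consRow r₁) (passes T″ h′ e′))
                                   (cong (λ V → cgo V h′) (sym (cong (newRowAfter (suc p) x) eT))))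
  ; stops = λ T′ i₀ e →
      let (T″ , i₁ , e′ , _) = consRow-stop⁻ r₁ _ T′ i₀ (trans (sym (scanStep T)) e)
          (T₂ , i₂ , e₂) = stops T″ i₁ e′
      in _ , _ , trans (scanStep _) (cong (consRow r₁) e₂)
  }
  where
  open RowInert (rowInert j h₁ p x T skips)

rowInert j h zero x T skips = record
  { above = λ { zero _ → refl }
  ; below = λ i _ → colHand′-cons j h [ x ] T i skip skips
  ; passes = λ T′ h′ e → trans (scanCol-cons j h [ x ] T skip skips) (cong (consRow [ x ]) e)
  ; stops = λ T′ i₀ e → _ , _ , trans (scanCol-cons j h [ x ] T skip skips) (cong (consRow [ x ]) e)
  }
rowInert j h (suc p) x [] skips = record
  { above = λ { zero _ → refl ; (suc i) _ → trans (colHand′-cons j h [ x ] [] i skip skips) (colHand′-[] j h i) }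
  ; below = λ i _ → colHand′-cons j h [ x ] [] i skip skips
  ; passes = λ { .[] .h refl → scanCol-cons j h [ x ] [] skip skips }
  ; stops = λ T′ i₀ ()
  }
rowInert j h (suc p) x (r ∷ T) skips with rowStep j h r in eb
... | placed r′ = record
  { above = λ { zero _ → refl ; (suc i) _ → trans (stopped _ i) (sym (stopped T i)) }
  ; below = λ { (suc i) _ → trans (stopped _ (suc i)) (sym (stopped T i)) }
  ; passes = λ T′ h′ e → ⊥-elim (stop≢go (trans (sym (scanCol-cons j h r T _ eb)) e))
  ; stops = λ _ _ _ → _ , _ , scanCol-cons j h r _ _ eb
  }
  where
  stopped : ∀ T′ i → colHand′ j h (r ∷ T′) (suc i) ≡ 0
  stopped T′ i = colHand′-cons j h r T′ i _ eb
... | bumped r′ h₁ =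
  rowInert-passThrough j h p x r T r′ h₁ skips
    (λ T′ i → colHand′-cons j h r T′ i _ eb) (λ T′ → scanCol-cons j h r T′ _ eb)
... | skip =
  rowInert-passThrough j h p x r T r h skips (λ T′ i → colHand′-cons j h r T′ i _ eb) (λ T′ → scanCol-cons j h r T′ _ eb)

colHand-inert-above : ∀ {j h p x T} → RowInert j h p x T → ∀ i → i ≤ suc p →
                      colHand j h (newRowAfter p x T) i ≡ colHand j h T i
colHand-inert-above inert zero _ = refl
colHand-inert-above inert (suc i) (s≤s le) = RowInert.above inert i le

colHand-inert-below : ∀ {j h p x T} → RowInert j h p x T → ∀ i → suc p ≤ i →
                      colHand j h (newRowAfter p x T) (suc i) ≡ colHand j h T i
colHand-inert-below inert (suc i) (s≤s le) = RowInert.below inert i le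

InertFor : ℕ → ℕ → NewRow → Tab → Set
InertFor j h nothing T = ⊤
InertFor j h (just (p , x)) T = RowInert j h p x T

addRow-passes : ∀ {j h} sh {T T′ h′} → InertFor j h sh T → scanCol j h T ≡ cgo T′ h′ →
                scanCol j h (addRow sh T) ≡ cgo (addRow sh T′) h′
addRow-passes nothing _ passes = passes
addRow-passes (just _) inert passes = RowInert.passes inert _ _ passes

addRow-stops : ∀ {j h} sh {T T′ i₀} → InertFor j h sh T → scanCol j h T ≡ cstop T′ i₀ →
               Σ Tab λ T₂ → Σ ℕ λ i₂ → scanCol j h (addRow sh T) ≡ cstop T₂ i₂
addRow-stops nothing _ stops = _ , _ , stops
addRow-stops (just _) inert stops = RowInert.stops inert _ _ stops

-- Agreement with the result of the first insertion.  When the second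
-- insertion reaches column N, it has only changed columns > N, so its rows
-- agree with the filling V produced by the first insertion in columns ≤ N.

AgreeUpTo : ℕ → List ℕ → List ℕ → Set
AgreeUpTo N r′ v = length r′ ≡ length v × (∀ j → j ≤ N → at r′ j ≡ at v j)

AgreeUpTo-refl : ∀ {N r} → AgreeUpTo N r r
AgreeUpTo-refl = refl , (λ j _ → refl)

LengthRel-resp : ∀ {N r v r′} → length r′ ≡ length v → LengthRel N r v → LengthRel N r r′
LengthRel-resp l (inj₁ e) = inj₁ (trans l e)
LengthRel-resp l (inj₂ (e , le)) = inj₂ (trans l e , subst (_≤ _) (sym l) le)

-- V arises from b's rows after column N+2 by changes up to column N+1, so a
-- row agreeing with V up to column N+2 is related as in the comparison with c
sameColRel : ∀ {n h r₁ v r′} → AgreeUpTo (suc (suc n)) r′ v → ChangedUpTo (suc n) h r₁ v →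
             SameColRel (suc (suc n)) h r₁ r′
sameColRel {n} {h} {r₁} {v} {r′} (l , agree) (above , anyCol , len) =
    trans (agree (suc (suc n)) ≤-refl) (above (suc (suc n)) ≤-refl)
  , left (anyCol (suc n))
  , LengthRel-resp {suc (suc n)} {r₁} {v} {r′} l len
  where
  left : (at v (suc n) ≡ at r₁ (suc n) ⊎ at v (suc n) ≤ h) → (at r′ (suc n) ≡ at r₁ (suc n) ⊎ at r′ (suc n) ≤ h)
  left (inj₁ e) = inj₁ (trans (agree (suc n) (n≤1+n _)) e)
  left (inj₂ le) = inj₂ (subst (_≤ h) (sym (agree (suc n) (n≤1+n _))) le)

-- … and a row agreeing with V up to column N+3 as in the comparison with a
nextColRel : ∀ {n h r₁ v r′} → AgreeUpTo (suc (suc (suc n))) r′ v → ChangedUpTo (suc n) h r₁ v →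
             NextColRel (suc (suc n)) r₁ r′
nextColRel {n} {h} {r₁} {v} {r′} (l , agree) (above , _ , len) =
    trans (agree (suc (suc n)) (n≤1+n _)) (above (suc (suc n)) ≤-refl)
  , trans (agree (suc (suc (suc n))) ≤-refl) (above (suc (suc (suc n))) (n≤1+n _))
  , LengthRel-resp {suc (suc n)} {r₁} {v} {r′} l len

-- A scan that passes column N changes rows only in column N, so agreement
-- up to column N becomes agreement up to any column M < N.
OnlyColumn : ℕ → List ℕ → List ℕ → Set
OnlyColumn N r r₁ = length r₁ ≡ length r × (∀ j → j ≢ N → at r₁ j ≡ at r j)

scanCol-onlyColumn : ∀ N h T T′ h′ → scanCol N h T ≡ cgo T′ h′ → Pointwise (OnlyColumn N) T T′
scanCol-onlyColumn N h [] T′ h′ refl = []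
scanCol-onlyColumn N h (r ∷ T) T′ h′ eq with rowStep N h r | rowStepView N h r
... | .(placed _) | placedV _ _ = ⊥-elim (stop≢go eq)
... | .(bumped _ _) | bumpedV _ _ _ with consRow-go⁻ _ _ _ _ eq
...   | T″ , e , refl = (length-setAt r N h , (λ j ne → at-setAt-other r N j h ne)) ∷ scanCol-onlyColumn N _ T T″ h′ e
scanCol-onlyColumn N h (r ∷ T) T′ h′ eq | .skip | skipV _ _ with consRow-go⁻ _ _ _ _ eq
... | T″ , e , refl = (refl , (λ j _ → refl)) ∷ scanCol-onlyColumn N h T T″ h′ e

scanCol-keepsAgreement : ∀ {N M T T′ V} → M < N → Pointwise (OnlyColumn N) T T′ →
                         Pointwise (AgreeUpTo N) T V → Pointwise (AgreeUpTo M) T′ V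
scanCol-keepsAgreement M<N [] [] = []
scanCol-keepsAgreement M<N ((l , only) ∷ onlys) ((l′ , agree) ∷ agrees) =
  (trans l l′ , (λ j j≤M → trans (only j (<⇒≢ (≤-<-trans j≤M M<N))) (agree j (≤-trans j≤M (<⇒≤ M<N)))))
  ∷ scanCol-keepsAgreement M<N onlys agrees

-- Part (1): comparison of the insertion of b with that of c ≥ b.
--
-- DominatedIn sh B C j : in column j the scanning values B of b are bounded by
-- the scanning values C of c, where rows below a new row created by b are
-- shifted down by one (in columns j ≥ 2) when read in C.

DominatedIn : NewRow → (ℕ → ℕ → ℕ) → (ℕ → ℕ → ℕ) → ℕ → Set
DominatedIn nothing B C j = ∀ i → B i j ≤ C i j
DominatedIn (just (p , x)) B C j = ∀ i → (i ≤ suc p → B i j ≤ C i j) × (2 ≤ j → suc p ≤ i → B i j ≤ C (suc i) j)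

DominatedIn-cong : ∀ sh j {B B′ C C′} → (∀ i → B i j ≡ B′ i j) → (∀ i → C i j ≡ C′ i j) →
                   DominatedIn sh B′ C′ j → DominatedIn sh B C j
DominatedIn-cong nothing j eB eC d i = subst₂ _≤_ (sym (eB i)) (sym (eC i)) (d i)
DominatedIn-cong (just _) j eB eC d i =
    (λ l → subst₂ _≤_ (sym (eB i)) (sym (eC i)) (proj₁ (d i) l))
  , (λ j2 l → subst₂ _≤_ (sym (eB i)) (sym (eC (suc i))) (proj₂ (d i) j2 l))

DominatedIn-zero : ∀ sh j {B C} → (∀ i → B i j ≡ 0) → DominatedIn sh B C j
DominatedIn-zero nothing j z i = subst (_≤ _) (sym (z i)) z≤n
DominatedIn-zero (just _) j z i = (λ _ → subst (_≤ _) (sym (z i)) z≤n) , (λ _ _ → subst (_≤ _) (sym (z i)) z≤n)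

colHand-compare : ∀ {N hb hc Tb Tc} → hb ≤ hc → (∀ i → colHand′ N hb Tb i ≤ colHand′ N hc Tc i) →
            ∀ i → colHand N hb Tb i ≤ colHand N hc Tc i
colHand-compare le _ zero = le
colHand-compare _ cmp (suc i) = cmp i

record LargerPasses (n hb hc hb′ : ℕ) (Tb Tc V : Tab) : Set where
  field
    Tc′      : Tab
    hc′      : ℕ
    c-passes : scanCol (suc (suc n)) hc Tc ≡ cgo Tc′ hc′
    out-≤    : hb′ ≤ hc′
    column-≤ : ∀ i → colHand′ (suc (suc n)) hb Tb i ≤ colHand′ (suc (suc n)) hc Tc i
    agrees   : Pointwise (AgreeUpTo (suc n)) Tc′ V

largerPasses : ∀ n hb hc Tb Tc Tb′ hb′ V → scanCol (suc (suc n)) hb Tb ≡ cgo Tb′ hb′ → hb ≤ hc →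
  Pointwise (ChangedUpTo (suc n) hb′) Tb′ V → Pointwise (AgreeUpTo (suc (suc n))) Tc V → LargerPasses n hb hc hb′ Tb Tc V
largerPasses n hb hc Tb Tc Tb′ hb′ V b-passes le changes agrees = record
  { Tc′ = Tc′ ; hc′ = hc′ ; c-passes = c-passes ; out-≤ = out-≤ ; column-≤ = column-≤
  ; agrees = scanCol-keepsAgreement (n<1+n _) (scanCol-onlyColumn N hc Tc Tc′ hc′ c-passes) agrees }
  where
  N = suc (suc n)
  related : Pointwise (SameColRel N hb′) (colTab (scanCol N hb Tb)) Tc
  related = subst (λ X → Pointwise (SameColRel N hb′) (colTab X) Tc) (sym b-passes)
              (Pointwise.transitive (λ c a → sameColRel a c) changes (Pointwise.symmetric (λ a → a) agrees))
  compared = columnCompare-≤ N (s≤s (s≤s z≤n)) hb′ hb hc Tb Tc le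
               (subst (λ X → hb′ ≤ colOut X) (sym b-passes) ≤-refl) related
  column-≤ = proj₁ compared
  c-continues : Continues (scanCol N hc Tc)
  c-continues = proj₂ compared (subst Continues (sym b-passes) (cgo Tb′ hb′))
  passing : ∀ X → Continues X → Σ Tab λ T → Σ ℕ λ h → X ≡ cgo T h
  passing .(cgo T h) (cgo T h) = T , h , refl
  Tc′ = proj₁ (passing _ c-continues)
  hc′ = proj₁ (proj₂ (passing _ c-continues))
  c-passes = proj₂ (proj₂ (passing _ c-continues))
  -- compare the hands below the last row
  K = length Tb + length Tc
  out-≤ : hb′ ≤ hc′
  out-≤ = subst₂ _≤_ (colHand′-belowColumn N hb Tb Tb′ hb′ K b-passes (m≤m+n _ _))
                     (colHand′-belowColumn N hc Tc Tc′ hc′ K c-passes (m≤n+m _ _)) (column-≤ K)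

-- Column 1: b's new one-box row [hb] goes after row p; c's one-box row goes
-- below it since hb ≤ hc, so c's values in column 1 are hc down to row p+2.
firstColumn-larger : ∀ hb hc Tb Tc → hb ≤ hc → length Tc ≡ length Tb →
  ∀ j → DominatedIn (just (lowestLe hb Tb , hb)) (hands 1 hb Tb) (hands 1 hc (newRowAfter (lowestLe hb Tb) hb Tc)) j
firstColumn-larger hb hc Tb Tc le sameRows j i = (λ _ → firstCol i i (n≤1+n _)) , (λ _ _ → firstCol i (suc i) ≤-refl)
  where
  p = lowestLe hb Tb
  Tc⁺ = newRowAfter p hb Tc
  p≤ : p ≤ length Tc
  p≤ = subst (p ≤_) (sym sameRows) (lowestLe-≤ hb Tb)
  belowNewRow : suc p ≤ lowestLe hc Tc⁺
  belowNewRow = lowestLe-≥ hc Tc⁺ (suc p) (s≤s z≤n) (subst (suc p ≤_) (sym (length-newRowAfter p hb Tc)) (s≤s p≤))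
                  (subst (λ r → at r 1 ≤ hc) (sym (rowAt-newRowAfter p hb Tc p≤)) le)
  firstCol : ∀ i i′ → i′ ≤ suc i → hands 1 hb Tb i j ≤ hands 1 hc Tc⁺ i′ j
  firstCol i i′ i′≤ =
    if-mono ((j ≡ᵇ 1) ∧ (i ≤ᵇ suc p)) ((j ≡ᵇ 1) ∧ (i′ ≤ᵇ suc (lowestLe hc Tc⁺))) hb hc within le
    where
    within : T ((j ≡ᵇ 1) ∧ (i ≤ᵇ suc p)) → T ((j ≡ᵇ 1) ∧ (i′ ≤ᵇ suc (lowestLe hc Tc⁺)))
    within t = let (j1 , i≤) = Equivalence.to T-∧ t in
      Equivalence.from T-∧ (j1 , ≤⇒≤ᵇ (≤-trans i′≤ (s≤s (≤-trans (≤ᵇ⇒≤ i (suc p) i≤) belowNewRow))))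

-- Column by column, from the starting column N = n+1 down to column 1:
-- b inserted into Tb yields V and possibly a new row; c is inserted into a
-- filling Tc agreeing with V up to column N, with that new row added.
compare-larger : ∀ n hb hc Tb Tc sh V → scanColumns (suc n) hb Tb ≡ (sh , V) → hb ≤ hc →
  Pointwise (AgreeUpTo (suc n)) Tc V →
  ∀ j → DominatedIn sh (hands (suc n) hb Tb) (hands (suc n) hc (addRow sh Tc)) j
compare-larger zero hb hc Tb Tc .(just (lowestLe hb Tb , hb)) .Tb refl le agrees =
  firstColumn-larger hb hc Tb Tc le (Pointwise-length agrees)
compare-larger (suc n) hb hc Tb Tc sh V e le agrees = byScan (scanCol N hb Tb) sh V e refl agrees
  where
  N = suc (suc n)
  N2 : 2 ≤ N
  N2 = s≤s (s≤s z≤n)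
  atStart : ∀ Tc′ i i′ → colHand N hb Tb i ≤ colHand N hc Tc′ i′ → hands N hb Tb i N ≤ hands N hc Tc′ i′ N
  atStart Tc′ i i′ = subst₂ _≤_ (sym (hands-startCol N hb Tb i N2)) (sym (hands-startCol N hc Tc′ i′ N2))
  rightOfStart : ∀ sh j → N < j → DominatedIn sh (hands N hb Tb) (hands N hc (addRow sh Tc)) j
  rightOfStart sh j N<j = DominatedIn-zero sh j {hands N hb Tb} {hands N hc (addRow sh Tc)} (λ i → hands-beyond N hb Tb i j N<j)
  byScan : ∀ X sh V → scanColumnsAfter (suc n) X ≡ (sh , V) → scanCol N hb Tb ≡ X → Pointwise (AgreeUpTo N) Tc V →
           ∀ j → DominatedIn sh (hands N hb Tb) (hands N hc (addRow sh Tc)) j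
  byScan (cstop Tb′ i₀) .nothing .Tb′ refl b-stops agrees =
    byColumn N _
      (λ j j<N → DominatedIn-zero nothing j {hands N hb Tb} {hands N hc Tc}
                   (λ i → hands-stopped n hb Tb Tb′ i₀ i j b-stops j<N))
      (λ i → atStart Tc i i (colHand-compare le (proj₁ (columnCompare-≤ N N2 0 hb hc Tb Tc le z≤n related)) i))
      (rightOfStart nothing)
    where
    related : Pointwise (SameColRel N 0) (colTab (scanCol N hb Tb)) Tc
    related = subst (λ X → Pointwise (SameColRel N 0) (colTab X) Tc) (sym b-stops)
                (Pointwise.symmetric (λ a → sameColRel a ChangedUpTo-refl) agrees)
  byScan (cgo Tb′ hb′) sh V e b-passes agrees =
    byColumn N _
      (λ j j<N → DominatedIn-cong sh j {hands N hb Tb} {hands (suc n) hb′ Tb′} {hands N hc (addRow sh Tc)}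
                   (λ i → hands-continue n hb Tb Tb′ hb′ i j b-passes j<N)
                   (λ i → hands-continue n hc (addRow sh Tc) (addRow sh Tc′) hc′ i j
                            (addRow-passes sh (newRowInert sh e) c-passes) j<N)
                   (compare-larger n hb′ hc′ Tb′ Tc′ sh V e out-≤ agrees′ j))
      (startColumn sh e)
      (rightOfStart sh)
    where
    open LargerPasses (largerPasses n hb hc Tb Tc Tb′ hb′ V b-passes le
                         (subst (λ S → Pointwise (ChangedUpTo (suc n) hb′) Tb′ (proj₂ S)) e (scanColumns-changes n hb′ Tb′))
                         agrees)
      renaming (agrees to agrees′)
    -- b's new one-box row holds an entry x ≤ hb′ ≤ c's hands, so c skips it
    newRowInert : ∀ sh → scanColumns (suc n) hb′ Tb′ ≡ (sh , V) → InertFor N hc sh Tc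
    newRowInert nothing _ = tt
    newRowInert (just (p , x)) e′ =
      rowInert N hc p x Tc (singleton-skip N _ x N2 (inj₁ (≤-trans x≤hb′ (≤-trans (hb′≤ p) (column-≤ p)))))
      where
      x≤hb′ = proj₁ (newRow-bounds n hb′ Tb′ p x (cong proj₁ e′))
      hb′≤ : ∀ i → hb′ ≤ colHand′ N hb Tb i
      hb′≤ i = subst (λ X → colOut X ≤ colHand′ N hb Tb i) b-passes (colOut-≤-colHand′ N hb Tb i)
    startColumn : ∀ sh → scanColumns (suc n) hb′ Tb′ ≡ (sh , V) → DominatedIn sh (hands N hb Tb) (hands N hc (addRow sh Tc)) N
    startColumn nothing _ i = atStart Tc i i (colHand-compare le column-≤ i)
    startColumn (just (p , x)) e′ i =
        (λ i≤ → atStart Ins i i (subst (_ ≤_) (sym (colHand-inert-above inert i i≤)) (colHand-compare le column-≤ i)))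
      , (λ _ ≤i → atStart Ins i (suc i) (subst (_ ≤_) (sym (colHand-inert-below inert i ≤i)) (colHand-compare le column-≤ i)))
      where
      Ins = newRowAfter p x Tc
      inert = newRowInert (just (p , x)) e′

-- Part (2): comparison of the insertion of b with that of a < b.
--
-- ExceedsIn sh B A j : wherever b's scanning value B in column j is nonzero,
-- it exceeds a's scanning value A in column j+1 (rows below a new row created
-- by b shifted down by one in columns j ≥ 2).

ExceedsIn : NewRow → (ℕ → ℕ → ℕ) → (ℕ → ℕ → ℕ) → ℕ → Set
ExceedsIn nothing B A j = ∀ i → 0 < B i j → A i (suc j) < B i j
ExceedsIn (just (p , x)) B A j =
  ∀ i → 0 < B i j → (i ≤ suc p → A i (suc j) < B i j) × (2 ≤ j → suc p ≤ i → A (suc i) (suc j) < B i j)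

ExceedsIn-cong : ∀ sh j {B B′ A A′} → (∀ i → B i j ≡ B′ i j) → (∀ i → A i (suc j) ≡ A′ i (suc j)) →
                 ExceedsIn sh B′ A′ j → ExceedsIn sh B A j
ExceedsIn-cong nothing j eB eA d i pos =
  subst₂ _<_ (sym (eA i)) (sym (eB i)) (d i (subst (0 <_) (eB i) pos))
ExceedsIn-cong (just _) j eB eA d i pos =
    (λ l → subst₂ _<_ (sym (eA i)) (sym (eB i)) (proj₁ (d i (subst (0 <_) (eB i) pos)) l))
  , (λ j2 l → subst₂ _<_ (sym (eA (suc i))) (sym (eB i)) (proj₂ (d i (subst (0 <_) (eB i) pos)) j2 l))

ExceedsIn-noB : ∀ sh j {B A} → (∀ i → B i j ≡ 0) → ExceedsIn sh B A j
ExceedsIn-noB nothing j z i pos = ⊥-elim (<-irrefl (sym (z i)) pos)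
ExceedsIn-noB (just _) j z i pos = ⊥-elim (<-irrefl (sym (z i)) pos)

ExceedsIn-noA : ∀ sh j {B A} → (∀ i → A i (suc j) ≡ 0) → ExceedsIn sh B A j
ExceedsIn-noA nothing j z i pos = subst (_< _) (sym (z i)) pos
ExceedsIn-noA (just _) j z i pos = (λ _ → subst (_< _) (sym (z i)) pos) , (λ _ _ → subst (_< _) (sym (z (suc i))) pos)

-- Column 1: b's only nonzero value there is hb, while a's values in column 2
-- are at most g < hb.
firstColumn-smaller : ∀ hb g Tb Ta → g < hb →
  ∀ j → ExceedsIn (just (lowestLe hb Tb , hb)) (hands 1 hb Tb) (hands 2 g (newRowAfter (lowestLe hb Tb) hb Ta)) j
firstColumn-smaller hb g Tb Ta lt j i pos = (λ _ → a-below i) , (λ j2 _ → ⊥-elim (<⇒≱ j2 (≤-reflexive j≡1)))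
  where
  p = lowestLe hb Tb
  Ta⁺ = newRowAfter p hb Ta
  inFirstCol : T ((j ≡ᵇ 1) ∧ (i ≤ᵇ suc p))
  inFirstCol = if-positive ((j ≡ᵇ 1) ∧ (i ≤ᵇ suc p)) hb pos
  j≡1 : j ≡ 1
  j≡1 = ≡ᵇ⇒≡ j 1 (proj₁ (Equivalence.to T-∧ inFirstCol))
  b-is-hb : hands 1 hb Tb i j ≡ hb
  b-is-hb = if-true ((j ≡ᵇ 1) ∧ (i ≤ᵇ suc p)) hb inFirstCol
  a-below : ∀ i′ → hands 2 g Ta⁺ i′ (suc j) < hands 1 hb Tb i j
  a-below i′ rewrite b-is-hb | j≡1 =
    subst (_< hb) (sym (hands-startCol 2 g Ta⁺ i′ ≤-refl)) (≤-<-trans (colHand-≤ 2 g Ta⁺ i′) lt)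

-- Column by column, from b's starting column N = n+1 (a starts in N+1):
-- b inserted into Tb yields V and possibly a new row; a is inserted into a
-- filling Ta agreeing with V up to column N+1, with that new row added.
compare-smaller : ∀ n hb g Tb Ta sh V → scanColumns (suc n) hb Tb ≡ (sh , V) → g < hb → All PosDecreasing Tb →
  Pointwise (AgreeUpTo (suc (suc n))) Ta V →
  ∀ j → ExceedsIn sh (hands (suc n) hb Tb) (hands (suc (suc n)) g (addRow sh Ta)) j
compare-smaller zero hb g Tb Ta .(just (lowestLe hb Tb , hb)) .Tb refl lt _ _ = firstColumn-smaller hb g Tb Ta lt
compare-smaller (suc n) hb g Tb Ta sh V e lt ps agrees = byScan (scanCol N hb Tb) sh V e refl agrees
  where
  N = suc (suc n)
  N2 : 2 ≤ N
  N2 = s≤s (s≤s z≤n)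
  N+1≥2 : 2 ≤ suc N
  N+1≥2 = s≤s (s≤s z≤n)
  atStart : ∀ Ta′ i i′ → 0 < hands N hb Tb i N →
            (0 < colHand N hb Tb i → colHand (suc N) g Ta′ i′ < colHand N hb Tb i) →
            hands (suc N) g Ta′ i′ (suc N) < hands N hb Tb i N
  atStart Ta′ i i′ pos cmp = subst₂ _<_ (sym (hands-startCol (suc N) g Ta′ i′ N+1≥2)) (sym (hands-startCol N hb Tb i N2))
                               (cmp (subst (0 <_) (hands-startCol N hb Tb i N2) pos))
  columnHands : (∀ i → 0 < colHand′ N hb Tb i → colHand′ (suc N) g Ta i < colHand′ N hb Tb i) →
                ∀ i → 0 < colHand N hb Tb i → colHand (suc N) g Ta i < colHand N hb Tb i
  columnHands _ zero _ = lt
  columnHands cmp (suc i) pos = cmp i pos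
  rightOfStart : ∀ sh j → N < j → ExceedsIn sh (hands N hb Tb) (hands (suc N) g (addRow sh Ta)) j
  rightOfStart sh j N<j = ExceedsIn-noB sh j {hands N hb Tb} {hands (suc N) g (addRow sh Ta)} (λ i → hands-beyond N hb Tb i j N<j)
  byScan : ∀ X sh V → scanColumnsAfter (suc n) X ≡ (sh , V) → scanCol N hb Tb ≡ X → Pointwise (AgreeUpTo (suc N)) Ta V →
           ∀ j → ExceedsIn sh (hands N hb Tb) (hands (suc N) g (addRow sh Ta)) j
  byScan (cstop Tb′ i₀) .nothing .Tb′ refl b-stops agrees =
    byColumn N _
      (λ j j<N → ExceedsIn-noB nothing j {hands N hb Tb} {hands (suc N) g Ta}
                   (λ i → hands-stopped n hb Tb Tb′ i₀ i j b-stops j<N))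
      (λ i pos → atStart Ta i i pos (columnHands (proj₁ (columnCompare-< N N2 hb g Tb Ta lt ps related)) i))
      (rightOfStart nothing)
    where
    related : Pointwise (NextColRel N) (colTab (scanCol N hb Tb)) Ta
    related = subst (λ X → Pointwise (NextColRel N) (colTab X) Ta) (sym b-stops)
                (Pointwise.symmetric (λ a → nextColRel {h = 0} a ChangedUpTo-refl) agrees)
  byScan (cgo Tb′ hb′) sh V e b-passes agrees =
    byColumn N (ExceedsIn sh (hands N hb Tb) (hands (suc N) g (addRow sh Ta))) leftOfStart (startColumn sh e) (rightOfStart sh)
    where
    changes : Pointwise (ChangedUpTo (suc n) hb′) Tb′ V
    changes = subst (λ S → Pointwise (ChangedUpTo (suc n) hb′) Tb′ (proj₂ S)) e (scanColumns-changes n hb′ Tb′)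
    related : Pointwise (NextColRel N) (colTab (scanCol N hb Tb)) Ta
    related = subst (λ X → Pointwise (NextColRel N) (colTab X) Ta) (sym b-passes)
                (Pointwise.transitive (λ c a → nextColRel a c) changes (Pointwise.symmetric (λ a → a) agrees))
    compared = columnCompare-< N N2 hb g Tb Ta lt ps related
    a-out< : colOut (scanCol (suc N) g Ta) < hb′
    a-out< = subst (λ X → colOut (scanCol (suc N) g Ta) < colOut X) b-passes
               (proj₂ compared (subst Continues (sym b-passes) (cgo Tb′ hb′)))
    -- b's new one-box row sits in column 1 and a scans columns ≥ 3, so a skips it
    newRowInert : ∀ p x → RowInert (suc N) g p x Ta
    newRowInert p x =
      rowInert (suc N) g p x Ta (singleton-skip (suc N) (colHand′ (suc N) g Ta p) x N+1≥2 (inj₂ (s≤s (s≤s (s≤s z≤n)))))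
    inertFor : ∀ sh → InertFor (suc N) g sh Ta
    inertFor nothing = tt
    inertFor (just (p , x)) = newRowInert p x
    leftOfStart : ∀ j → j < N → ExceedsIn sh (hands N hb Tb) (hands (suc N) g (addRow sh Ta)) j
    leftOfStart j j<N = byAScan (scanCol (suc N) g Ta) refl
      where
      byAScan : ∀ Y → scanCol (suc N) g Ta ≡ Y → ExceedsIn sh (hands N hb Tb) (hands (suc N) g (addRow sh Ta)) j
      byAScan (cstop Ta′ i₀) a-stops =
        let (T₂ , i₂ , stops) = addRow-stops sh (inertFor sh) a-stops
        in ExceedsIn-noA sh j {hands N hb Tb} {hands (suc N) g (addRow sh Ta)}
             (λ i → hands-stopped (suc n) g (addRow sh Ta) T₂ i₂ i (suc j) stops (s≤s j<N))
      byAScan (cgo Ta′ g′) a-passes =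
        ExceedsIn-cong sh j {hands N hb Tb} {hands (suc n) hb′ Tb′} {hands (suc N) g (addRow sh Ta)}
          (λ i → hands-continue n hb Tb Tb′ hb′ i j b-passes j<N)
          (λ i → hands-continue (suc n) g (addRow sh Ta) (addRow sh Ta′) g′ i (suc j)
                   (addRow-passes sh (inertFor sh) a-passes) (s≤s j<N))
          (compare-smaller n hb′ g′ Tb′ Ta′ sh V e (subst (λ Y → colOut Y < hb′) a-passes a-out<)
             (colTab-posDecreasing N hb Tb Tb′ hb′ N2 ps b-passes)
             (scanCol-keepsAgreement (n<1+n N) (scanCol-onlyColumn (suc N) g Ta Ta′ g′ a-passes) agrees) j)
    startColumn : ∀ sh → scanColumns (suc n) hb′ Tb′ ≡ (sh , V) →
                  ExceedsIn sh (hands N hb Tb) (hands (suc N) g (addRow sh Ta)) N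
    startColumn nothing _ i pos = atStart Ta i i pos (columnHands (proj₁ compared) i)
    startColumn (just (p , x)) _ i pos =
        (λ i≤ → atStart Ins i i pos
                  (λ pos′ → subst (_< _) (sym (colHand-inert-above inert i i≤)) (columnHands (proj₁ compared) i pos′)))
      , (λ _ ≤i → atStart Ins i (suc i) pos
                  (λ pos′ → subst (_< _) (sym (colHand-inert-below inert i ≤i)) (columnHands (proj₁ compared) i pos′)))
      where
      Ins = newRowAfter p x Ta
      inert = newRowInert p x

at-positive : ∀ r → All (0 <_) r → ∀ j → 1 ≤ j → j ≤ length r → 0 < at r j
at-positive (x ∷ r) (px ∷ pr) (suc zero) _ _ = px
at-positive (x ∷ r) (px ∷ pr) (suc (suc j)) _ (s≤s l) = at-positive r pr (suc j) (s≤s z≤n) l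

rows-posDecreasing : ∀ U → All (All (0 <_)) U →
  (∀ i j → 1 ≤ i → i ≤ numRows U → 1 ≤ j → suc j ≤ rowLen U i → entry U i (suc j) < entry U i j) →
  All PosDecreasing U
rows-posDecreasing [] _ _ = []
rows-posDecreasing (r ∷ U) (pr ∷ pU) decreasing =
  (at-positive r pr , (λ j → decreasing 1 j (s≤s z≤n) (s≤s z≤n)))
  ∷ rows-posDecreasing U pU (λ { (suc i) j _ i≤ → decreasing (suc (suc i)) j (s≤s z≤n) (s≤s i≤) })

rct-posDecreasing : ∀ U → IsRCT U → All PosDecreasing U
rct-posDecreasing U rct = rows-posDecreasing U (IsRCT.positive rct) (IsRCT.rowStrict rct)

-- The insertion of c ≥ b into U ← b passes column m+2 without any change:
-- every row of U ← b has length ≤ m+1, and entries in column m+1 are ≤ b.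

maxLen-bound : ∀ T → All (λ r → length r ≤ maxLen T) T
maxLen-bound [] = []
maxLen-bound (r ∷ T) =
  m≤m⊔n (length r) (maxLen T) ∷ All.map (λ l → ≤-trans l (m≤n⊔m (length r) (maxLen T))) (maxLen-bound T)

-- rows skipped by a scan of column M+1 with c in hand
ShortRow : ℕ → ℕ → List ℕ → Set
ShortRow M c r = length r ≤ M × (length r ≡ M → at r M ≤ c)

shortRow-skip : ∀ M c r → ShortRow M c r → rowStep (suc M) c r ≡ skip
shortRow-skip M c r (short , lastEntry) with rowStep (suc M) c r | rowStepView (suc M) c r
... | .(placed _) | placedV len lt = ⊥-elim (<⇒≱ lt (lastEntry len))
... | .(bumped _ _) | bumpedV M+1≤ _ _ = ⊥-elim (<⇒≱ M+1≤ short)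
... | .skip | skipV _ _ = refl

scanCol-allSkip : ∀ j h T → All (λ r → rowStep j h r ≡ skip) T → scanCol j h T ≡ cgo T h
scanCol-allSkip j h [] [] = refl
scanCol-allSkip j h (r ∷ T) (s ∷ ss) = trans (scanCol-cons j h r T skip s) (cong (consRow r) (scanCol-allSkip j h T ss))

All-newRowAfter : ∀ {P : List ℕ → Set} p x T → All P T → P [ x ] → All P (newRowAfter p x T)
All-newRowAfter zero x T a px = px ∷ a
All-newRowAfter (suc p) x [] [] px = px ∷ []
All-newRowAfter (suc p) x (r ∷ T) (a ∷ as) px = a ∷ All-newRowAfter p x T as px

changed-short : ∀ {m b c u v} → b ≤ c → length u ≤ m → ChangedUpTo (suc m) b u v → ShortRow (suc m) c v
changed-short {m} {b} {c} {u} {v} b≤c short (_ , anyCol , inj₁ e) =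
  ≤-trans (≤-reflexive e) (≤-trans short (n≤1+n m)) , (λ e′ → ⊥-elim (1+n≰n (subst (_≤ m) (trans (sym e) e′) short)))
changed-short {m} {b} {c} {u} {v} b≤c short (_ , anyCol , inj₂ (_ , l)) = l , (λ _ → lastEntry (anyCol (suc m)))
  where
  lastEntry : at v (suc m) ≡ at u (suc m) ⊎ at v (suc m) ≤ b → at v (suc m) ≤ c
  lastEntry (inj₁ e) = subst (_≤ c) (sym (trans e (at-beyond u (suc m) (s≤s short)))) z≤n
  lastEntry (inj₂ le) = ≤-trans le b≤c

changed-shortRows : ∀ {m b c U V} → b ≤ c → All (λ u → length u ≤ m) U → Pointwise (ChangedUpTo (suc m) b) U V →
                    All (ShortRow (suc m) c) V
changed-shortRows b≤c [] [] = []
changed-shortRows b≤c (s ∷ ss) (ch ∷ chs) = changed-short b≤c s ch ∷ changed-shortRows b≤c ss chs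

data Outcome (U : Tab) (b : ℕ) : Set where
  noNewRow : ∀ V → scanColumns (suc (maxLen U)) b U ≡ (nothing , V) →
             2 ≤ newCol U b → newCol U b ≤ suc (maxLen U) → Outcome U b
  withNewRow : ∀ p x V → scanColumns (suc (maxLen U)) b U ≡ (just (p , x) , V) →
               newCol U b ≡ 1 → newRow U b ≡ suc p → Outcome U b

outcome : ∀ U b → Outcome U b
outcome U b with scanColumns (suc (maxLen U)) b U in e | stopCol (suc (maxLen U)) b U in ec
               | stopRow (suc (maxLen U)) b U in er | stopKind (maxLen U) b U
... | nothing , V | _ | _ | inColumn j2 j≤ = noNewRow V e (subst (2 ≤_) (sym ec) j2) (subst (_≤ _) (sym ec) j≤)
... | just (p , x) , V | _ | _ | inNewRow .p .x = withNewRow p x V e ec er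

module _ (U : Tab) (b : ℕ) (sh : NewRow) (V : Tab) (e : scanColumns (suc (maxLen U)) b U ≡ (sh , V)) where

  private
    m = maxLen U

  insertion≡ : U ←ᵣ b ≡ addRow sh V
  insertion≡ = trans (insertion-decomposes m b U) (cong (λ S → addRow (proj₁ S) (proj₂ S)) e)

  changes : Pointwise (ChangedUpTo (suc m) b) U V
  changes = subst (λ S → Pointwise (ChangedUpTo (suc m) b) U (proj₂ S)) e (scanColumns-changes m b U)

  numRows-insertion : numRows (U ←ᵣ b) ≡ numRows (addRow sh V)
  numRows-insertion = cong length insertion≡

  numRows-V : numRows V ≡ numRows U
  numRows-V = sym (Pointwise-length changes)

  -- c ≥ b passes column m+2 of U ← b unchanged, so its scanning values in
  -- columns ≤ m+1 are those of an insertion starting in column m+1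
  larger-fromColumn : ∀ c → b ≤ c → ∀ i j → j ≤ suc m → scanNext U b c i j ≡ hands (suc m) c (addRow sh V) i j
  larger-fromColumn c b≤c i j j≤ =
    trans (cong (λ T → hands (suc (suc m)) c T i j) insertion≡)
          (hands-continue m c (addRow sh V) (addRow sh V) c i j
             (scanCol-allSkip _ c _ (All.map (λ {r} → shortRow-skip (suc m) c r) (short sh e))) (s≤s j≤))
    where
    shortV : All (ShortRow (suc m) c) V
    shortV = changed-shortRows b≤c (maxLen-bound U) changes
    short : ∀ sh′ → scanColumns (suc m) b U ≡ (sh′ , V) → All (ShortRow (suc m) c) (addRow sh′ V)
    short nothing _ = shortV
    short (just (p , x)) e′ =
      All-newRowAfter p x V shortV (s≤s z≤n , (λ 1≡m+1 → subst (λ j → at [ x ] j ≤ c) 1≡m+1 x≤c))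
      where
      x≤c : x ≤ c
      x≤c = ≤-trans (proj₁ (newRow-bounds m b U p x (cong proj₁ e′))) b≤c

  compare-c : ∀ c → b ≤ c → ∀ j → j ≤ suc m → DominatedIn sh (scanB U b) (scanNext U b c) j
  compare-c c b≤c j j≤ =
    DominatedIn-cong sh j {scanB U b} {scanB U b} {scanNext U b c} (λ _ → refl) (λ i → larger-fromColumn c b≤c i j j≤)
      (compare-larger m b c U V sh V e b≤c (Pointwise.refl AgreeUpTo-refl) j)

  compare-a : ∀ a → a < b → All PosDecreasing U → ∀ j → ExceedsIn sh (scanB U b) (scanNext U b a) j
  compare-a a a<b ps j =
    subst (λ T → ExceedsIn sh (scanB U b) (hands (suc (suc m)) a T) j) (sym insertion≡)
      (compare-smaller m b a U V sh V e a<b ps (Pointwise.refl AgreeUpTo-refl) j)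

PositiveRegion : Tab → ℕ → ℕ → ℕ → Set
PositiveRegion U b i j = (j ≡ newCol U b × i ≤ newRow U b) ⊎ (newCol U b < j × j ≤ suc (maxLen U))

scanB-positive : ∀ U b → 0 < b → All PosDecreasing U → ∀ i j → PositiveRegion U b i j → 0 < scanB U b i j
scanB-positive U b 0<b ps i j (inj₁ (refl , i≤)) = proj₂ (hands-positive (maxLen U) b U 0<b ps) i i≤
scanB-positive U b 0<b ps i j (inj₂ (jb<j , j≤)) = proj₁ (hands-positive (maxLen U) b U 0<b ps) i j jb<j j≤

positiveRegion-newRow : ∀ U b → newCol U b ≡ 1 → ∀ i j → i ≤ newRow U b → 1 ≤ j → j ≤ suc (maxLen U) →
                        PositiveRegion U b i j
positiveRegion-newRow U b jb≡1 i (suc zero) i≤ _ _ = inj₁ (sym jb≡1 , i≤)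
positiveRegion-newRow U b jb≡1 i (suc (suc j)) _ _ j≤ = inj₂ (subst (_< suc (suc j)) (sym jb≡1) (s≤s (s≤s z≤n)) , j≤)

numRows-noNewRow : ∀ U b V → scanColumns (suc (maxLen U)) b U ≡ (nothing , V) → numRows (U ←ᵣ b) ≡ numRows U
numRows-noNewRow U b V e = trans (numRows-insertion U b nothing V e) (numRows-V U b nothing V e)

numRows-withNewRow : ∀ U b p x V → scanColumns (suc (maxLen U)) b U ≡ (just (p , x) , V) →
                     numRows (U ←ᵣ b) ≡ suc (numRows U)
numRows-withNewRow U b p x V e =
  trans (numRows-insertion U b _ V e) (trans (length-newRowAfter p x V) (cong suc (numRows-V U b _ V e)))

theorem-1a : ∀ U b c → b ≤ c → numRows (U ←ᵣ b) ≡ numRows U →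
  ∀ i j → ((j ≡ newCol U b × i ≤ newRow U b) ⊎ (newCol U b < j × j < suc (maxLen U) × i ≤ numRows U)) →
  scanB U b i j ≤ scanNext U b c i j
theorem-1a U b c b≤c sameRows i j region with outcome U b
... | noNewRow V e _ jb≤ = compare-c U b nothing V e c b≤c j (column region) i
  where
  column : (j ≡ newCol U b × i ≤ newRow U b) ⊎ (newCol U b < j × j < suc (maxLen U) × i ≤ numRows U) → j ≤ suc (maxLen U)
  column (inj₁ (refl , _)) = jb≤
  column (inj₂ (_ , j<m+1 , _)) = <⇒≤ j<m+1
... | withNewRow p x V e _ _ = ⊥-elim (1+n≰n (≤-reflexive (trans (sym (numRows-withNewRow U b p x V e)) sameRows)))

theorem-1b : ∀ U b c → b ≤ c → numRows (U ←ᵣ b) ≡ suc (numRows U) →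
  (∀ i j → i ≤ newRow U b → 1 ≤ j → j ≤ suc (maxLen U) → scanB U b i j ≤ scanNext U b c i j)
  × (∀ i j → newRow U b ≤ i → i ≤ suc (numRows U) → 2 ≤ j → j ≤ suc (maxLen U) →
     scanB U b i j ≤ scanNext U b c (suc i) j)
theorem-1b U b c b≤c grew with outcome U b
... | noNewRow V e _ _ = ⊥-elim (1+n≰n (≤-reflexive (trans (sym grew) (numRows-noNewRow U b V e))))
... | withNewRow p x V e _ ib≡ =
    (λ i j i≤ib _ j≤ → proj₁ (compare-c U b _ V e c b≤c j j≤ i) (subst (i ≤_) ib≡ i≤ib))
  , (λ i j ib≤i _ j2 j≤ → proj₂ (compare-c U b _ V e c b≤c j j≤ i) j2 (subst (_≤ i) ib≡ ib≤i))

theorem-2a : ∀ U a b → a < b → 0 < b → All PosDecreasing U → numRows (U ←ᵣ b) ≡ numRows U →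
  ∀ i j → ((j ≡ newCol U b × i ≤ newRow U b) ⊎ (newCol U b < j × j ≤ maxLen U × i ≤ numRows U)) →
  scanNext U b a i (suc j) < scanB U b i j
theorem-2a U a b a<b 0<b ps sameRows i j region with outcome U b
... | noNewRow V e _ _ = compare-a U b nothing V e a a<b ps j i (scanB-positive U b 0<b ps i j (inRegion region))
  where
  inRegion : (j ≡ newCol U b × i ≤ newRow U b) ⊎ (newCol U b < j × j ≤ maxLen U × i ≤ numRows U) → PositiveRegion U b i j
  inRegion (inj₁ here) = inj₁ here
  inRegion (inj₂ (jb<j , j≤m , _)) = inj₂ (jb<j , ≤-trans j≤m (n≤1+n _))
... | withNewRow p x V e _ _ = ⊥-elim (1+n≰n (≤-reflexive (trans (sym (numRows-withNewRow U b p x V e)) sameRows)))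

theorem-2b : ∀ U a b → a < b → 0 < b → All PosDecreasing U → newCol U b ≡ 1 →
  (∀ i j → i ≤ newRow U b → 1 ≤ j → j ≤ maxLen U → scanNext U b a i (suc j) < scanB U b i j)
  × (∀ i j → newRow U b ≤ i → i ≤ suc (numRows U) → 2 ≤ j → j ≤ suc (maxLen U) →
     scanNext U b a (suc i) (suc j) < scanB U b i j)
theorem-2b U a b a<b 0<b ps jb≡1 with outcome U b
... | noNewRow V e jb≥2 _ = ⊥-elim (<⇒≱ jb≥2 (≤-reflexive jb≡1))
... | withNewRow p x V e _ ib≡ =
    (λ i j i≤ib 1≤j j≤m → proj₁ (compare-a U b _ V e a a<b ps j i
                                   (positive i j (positiveRegion-newRow U b jb≡1 i j i≤ib 1≤j (≤-trans j≤m (n≤1+n _)))))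
                                (subst (i ≤_) ib≡ i≤ib))
  , (λ i j ib≤i _ j2 j≤ → proj₂ (compare-a U b _ V e a a<b ps j i (positive i j (inj₂ (subst (_< j) (sym jb≡1) j2 , j≤))))
                             j2 (subst (_≤ i) ib≡ ib≤i))
  where
  positive : ∀ i j → PositiveRegion U b i j → 0 < scanB U b i j
  positive = scanB-positive U b 0<b ps

mainTheorem5 : (U : Tab) → IsRCT U → (a b c : ℕ) → 1 ≤ a → a < b → b ≤ c →
  let k = numRows U
      m = maxLen U
      ib = newRow U b
      jb = newCol U b
      B = scanB U b
      C = scanNext U b c
      A = scanNext U b a
  in
  -- (1)(a)
  (numRows (U ←ᵣ b) ≡ k →
    ∀ i j → ((j ≡ jb × i ≤ ib) ⊎ (jb < j × j < suc m × i ≤ k)) →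
    B i j ≤ C i j)
  -- (1)(b)
  × (numRows (U ←ᵣ b) ≡ suc k →
    (∀ i j → i ≤ ib → 1 ≤ j → j ≤ suc m → B i j ≤ C i j)
    × (∀ i j → ib ≤ i → i ≤ suc k → 2 ≤ j → j ≤ suc m → B i j ≤ C (suc i) j))
  -- (2)(a)
  × (numRows (U ←ᵣ b) ≡ k →
    ∀ i j → ((j ≡ jb × i ≤ ib) ⊎ (jb < j × j ≤ m × i ≤ k)) →
    A i (suc j) < B i j)
  -- (2)(b)
  × (jb ≡ 1 →
    (∀ i j → i ≤ ib → 1 ≤ j → j ≤ m → A i (suc j) < B i j)
    × (∀ i j → ib ≤ i → i ≤ suc k → 2 ≤ j → j ≤ suc m → A (suc i) (suc j) < B i j))
mainTheorem5 U rct a b c 1≤a a<b b≤c =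
    theorem-1a U b c b≤c
  , theorem-1b U b c b≤c
  , theorem-2a U a b a<b 0<b ps
  , (λ jb≡1 → theorem-2b U a b a<b 0<b ps jb≡1)
  where
  ps : All PosDecreasing U
  ps = rct-posDecreasing U rct
  0<b : 0 < b
  0<b = <-≤-trans 1≤a (<⇒≤ a<b)
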